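{- With notation as in the context, the map $\eta_{*\mathcal H}:\Gamma_{\mathcal H}\backslash\Delta_{\mathcal H}\to\widehat\Gamma_{\mathcal H}\backslash\widehat\Delta_{\mathcal H}$, $\Gamma_{\mathcal H}\beta\mapsto\widehat\Gamma_{\mathcal H}\eta_{\mathcal H}(\beta)$, is bijective.
   Context: The Heisenberg Lie algebra $\mathcal H$ is the quotient of the free Lie algebra over $\mathbb Z$ on two generators by $[L_2,[L_2,L_2]]$. Its monoid $\Delta_{\mathcal H}=\mathrm{End}^{alg}_{\mathbb Z}(\mathcal H)\cap\mathrm{Aut}^{alg}_{\mathbb Q}(\mathcal H\otimes\mathbb Q)$ and group $\Gamma_{\mathcal H}=\mathrm{Aut}^{alg}_{\mathbb Z}(\mathcal H)$ are identified with $(M_2(\mathbb Z)\cap GL_2(\mathbb Q))\times\mathbb Z^2$ and $GL_2(\mathbb Z)\times\mathbb Z^2$ inside the group $GL_2(\mathbb Q)\times\mathbb Q^2$ with product $(A,\mathbf a)(B,\mathbf b)=(AB,A\mathbf b+\det(B)\mathbf a)$; similarly for each prime $p$, $\Delta_{\mathcal H_p}=(M_2(\mathbb Z_p)\cap GL_2(\mathbb Q_p))\times\mathbb Z_p^2$ and $\Gamma_{\mathcal H_p}=GL_2(\mathbb Z_p)\times\mathbb Z_p^2$ inside $GL_2(\mathbb Q_p)\times\mathbb Q_p^2$ with the same product. $\widehat\Gamma_{\mathcal H}=\prod_p\Gamma_{\mathcal H_p}$, and $\widehat\Delta_{\mathcal H}$ is the set of $(\alpha_p)\in\prod_p\Delta_{\mathcal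 H_p}$ with $\alpha_p\in\Gamma_{\mathcal H_p}$ for almost all $p$. $\eta_{\mathcal H}:\Delta_{\mathcal H}\to\widehat\Delta_{\mathcal H}$ is the diagonal embedding. -}

module Defs where

open import Data.Nat as ℕ using (ℕ; suc; _^_)
open import Data.Nat.Primality using (Prime)
open import Data.Integer as ℤ using (ℤ; _+_; _*_; _-_; -_; +_; 0ℤ; 1ℤ)
open import Data.Integer.Divisibility.Signed using (_∣_; ∣m∣n⇒∣m+n; ∣m⇒∣-m; ∣n⇒∣m*n; ∣m⇒∣m*n; ∣-refl)
open import Data.Integer.Tactic.RingSolver using (solve-∀)
open import Data.Product using (Σ; ∃; _×_; _,_)
open import Relation.Binary.PropositionalEquality using (_≡_; refl; subst)
open import Relation.Nullary using (¬_)

-- Generic 2×2 matrices, column vectors, and the group law of the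
-- semidirect product  GL₂ ⋉ (rank 2)  used in the paper:
--   (A , a)(B , b) = (A B , A b + det(B) a)

record M2 (R : Set) : Set where
  constructor mat
  field
    m11 m12 m21 m22 : R

record V2 (R : Set) : Set where
  constructor vec
  field
    v1 v2 : R

module Ops {R : Set} (_⊕_ _⊗_ : R → R → R) (⊖_ : R → R) where

  det : M2 R → R
  det (mat a b c d) = (a ⊗ d) ⊕ (⊖ (b ⊗ c))

  _·_ : M2 R → M2 R → M2 R
  mat a b c d · mat a' b' c' d' =
    mat ((a ⊗ a') ⊕ (b ⊗ c')) ((a ⊗ b') ⊕ (b ⊗ d'))
        ((c ⊗ a') ⊕ (d ⊗ c')) ((c ⊗ b') ⊕ (d ⊗ d'))

  act : M2 R → V2 R → V2 R
  act (mat a b c d) (vec x y) = vec ((a ⊗ x) ⊕ (b ⊗ y)) ((c ⊗ x) ⊕ (d ⊗ y))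

  _⊕v_ : V2 R → V2 R → V2 R
  vec x y ⊕v vec x' y' = vec (x ⊕ x') (y ⊕ y')

  scal : R → V2 R → V2 R
  scal r (vec x y) = vec (r ⊗ x) (r ⊗ y)

  _∘H_ : M2 R × V2 R → M2 R × V2 R → M2 R × V2 R
  (A , a) ∘H (B , b) = (A · B , (act A b ⊕v scal (det B) a))

module Eqs {R : Set} (_≈_ : R → R → Set) where

  _≈M_ : M2 R → M2 R → Set
  mat a b c d ≈M mat a' b' c' d' = (a ≈ a') × (b ≈ b') × (c ≈ c') × (d ≈ d')

  _≈V_ : V2 R → V2 R → Set
  vec x y ≈V vec x' y' = (x ≈ x') × (y ≈ y')

  _≈H_ : M2 R × V2 R → M2 R × V2 R → Set
  (A , a) ≈H (B , b) = (A ≈M B) × (a ≈V b)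

module OpsZ = Ops {ℤ} _+_ _*_ -_

-- Δ_H = (M₂(ℤ) ∩ GL₂(ℚ)) × ℤ²  : integer matrices with nonzero determinant
ΔH : Set
ΔH = Σ (M2 ℤ × V2 ℤ) λ { (A , _) → ¬ (OpsZ.det A ≡ 0ℤ) }

ΓH : Set
ΓH = Σ (M2 ℤ × V2 ℤ) λ { (A , _) → Σ ℤ λ u → OpsZ.det A * u ≡ 1ℤ }

_∼Γ_ : ΔH → ΔH → Set
(β , _) ∼Γ (β' , _) = Σ ΓH λ { (γ , _) → OpsZ._∘H_ γ β ≡ β' }

-- p-adic integers ℤ_p, as coherent sequences of integers
-- (x_n approximates x modulo p^n), with equality "congruent modulo
-- every p^n".

record ℤ[_] (p : ℕ) : Set where
  constructor padic
  field
    seq : ℕ → ℤ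
    coh : ∀ n → (+ (p ^ n)) ∣ (seq (suc n) - seq n)
open ℤ[_] public

module _ {p : ℕ} where

  infix 4 _≈p_
  _≈p_ : ℤ[ p ] → ℤ[ p ] → Set
  x ≈p y = ∀ n → (+ (p ^ n)) ∣ (seq x n - seq y n)

  private
    id+ : ∀ a b c d → (a + b) - (c + d) ≡ (a - c) + (b - d)
    id+ = solve-∀
    id* : ∀ a b c d → (a * b) - (c * d) ≡ a * (b - d) + (a - c) * d
    id* = solve-∀
    id- : ∀ a c → (- a) - (- c) ≡ - (a - c)
    id- = solve-∀
    id0 : ∀ a → a - a ≡ 0ℤ * a
    id0 = solve-∀

  ι : ℤ → ℤ[ p ]
  ι z = padic (λ _ → z) (λ n → subst (_ ∣_) (sym' (id0 z)) (∣n⇒∣m*n 0ℤ ∣-refl))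
    where
      sym' : ∀ {a b : ℤ} → a ≡ b → b ≡ a
      sym' refl = refl

  _+p_ : ℤ[ p ] → ℤ[ p ] → ℤ[ p ]
  x +p y = padic (λ n → seq x n + seq y n) λ n →
    subst (_ ∣_) (sym' (id+ (seq x (suc n)) (seq y (suc n)) (seq x n) (seq y n)))
      (∣m∣n⇒∣m+n (coh x n) (coh y n))
    where
      sym' : ∀ {a b : ℤ} → a ≡ b → b ≡ a
      sym' refl = refl

  _*p_ : ℤ[ p ] → ℤ[ p ] → ℤ[ p ]
  x *p y = padic (λ n → seq x n * seq y n) λ n →
    subst (_ ∣_) (sym' (id* (seq x (suc n)) (seq y (suc n)) (seq x n) (seq y n)))
      (∣m∣n⇒∣m+n (∣n⇒∣m*n (seq x (suc n)) (coh y n)) (∣m⇒∣m*n (seq y n) (coh x n)))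
    where
      sym' : ∀ {a b : ℤ} → a ≡ b → b ≡ a
      sym' refl = refl

  -p_ : ℤ[ p ] → ℤ[ p ]
  -p x = padic (λ n → - seq x n) λ n →
    subst (_ ∣_) (sym' (id- (seq x (suc n)) (seq x n))) (∣m⇒∣-m (coh x n))
    where
      sym' : ∀ {a b : ℤ} → a ≡ b → b ≡ a
      sym' refl = refl

module OpsP (p : ℕ) = Ops {ℤ[ p ]} _+p_ _*p_ -p_
module EqsP (p : ℕ) = Eqs {ℤ[ p ]} (_≈p_ {p})

-- Local monoid Δ_{H_p} = (M₂(ℤ_p) ∩ GL₂(ℚ_p)) × ℤ_p² and group
-- Γ_{H_p} = GL₂(ℤ_p) × ℤ_p².
-- Since ℚ_p = ℤ_p[1/p], det A is invertible in ℚ_p iff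
-- det A · u = p^k for some u ∈ ℤ_p and k ∈ ℕ.

InvQp : (p : ℕ) → ℤ[ p ] → Set
InvQp p x = Σ ℕ λ k → Σ ℤ[ p ] λ u → (x *p u) ≈p ι (+ (p ^ k))

UnitZp : (p : ℕ) → ℤ[ p ] → Set
UnitZp p x = Σ ℤ[ p ] λ u → (x *p u) ≈p ι 1ℤ

Δp : ℕ → Set
Δp p = Σ (M2 ℤ[ p ] × V2 ℤ[ p ]) λ { (A , _) → InvQp p (OpsP.det p A) }

Γp : ℕ → Set
Γp p = Σ (M2 ℤ[ p ] × V2 ℤ[ p ]) λ { (A , _) → UnitZp p (OpsP.det p A) }

ΓHat : Set
ΓHat = (p : ℕ) → Prime p → Γp p

-- Δ̂_H : families (α_p) ∈ ∏_p Δ_{H_p} with α_p ∈ Γ_{H_p} for almost all p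
-- (i.e. for all primes p beyond some bound N).
ΔHat : Set
ΔHat = Σ ((p : ℕ) → Prime p → Δp p) λ α →
         Σ ℕ λ N → (p : ℕ) (pp : Prime p) → N ℕ.< p →
           UnitZp p (OpsP.det p (Data.Product.proj₁ (Data.Product.proj₁ (α p pp))))

Fam : Set
Fam = (p : ℕ) → Prime p → M2 ℤ[ p ] × V2 ℤ[ p ]

famOf : ΔHat → Fam
famOf (α , _) p pp = Data.Product.proj₁ (α p pp)

_∼Γ̂_ : Fam → Fam → Set
α ∼Γ̂ α' = Σ ΓHat λ γ → (p : ℕ) (pp : Prime p) →
  EqsP._≈H_ p (OpsP._∘H_ p (Data.Product.proj₁ (γ p pp)) (α p pp)) (α' p pp)

ιM : ∀ {p} → M2 ℤ → M2 ℤ[ p ]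
ιM (mat a b c d) = mat (ι a) (ι b) (ι c) (ι d)

ιV : ∀ {p} → V2 ℤ → V2 ℤ[ p ]
ιV (vec x y) = vec (ι x) (ι y)

η : M2 ℤ × V2 ℤ → Fam
η (A , a) p _ = (ιM A , ιV a)

-- Well-definedness is immediate, as η maps Γ_H into Γ̂_H. For injectivity, suppose γ̂ η(β) = η(β′)
-- with β = (A, a), β′ = (B, b′) and d = det A. Locally γ_p = β′ β⁻¹, so the integer matrix
-- B adj(A) and the integer vector d b′ - B adj(A) a are divisible by d and d² in every ℤ_p, hence in ℤ,
-- since a nonzero integer divides M as soon as each prime power dividing it divides M. The resulting
-- integral γ satisfies γ β = β′, and det γ is a p-adic unit for every p, hence ±1.
--
-- For surjectivity, let α = (A_p, a_p) with A_p ∈ GL₂(ℤ_p) for p > N. At p ≤ N the Hermite normal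
-- form of A_p has diagonal (p^j, p^l) with j + l = v_p(det A_p). Put P = ∏ p^j, Q = ∏ p^l and choose
-- X by the Chinese remainder theorem so that B = (P X; 0 Q) has A_p B⁻¹ ∈ GL₂(ℤ_p) for every p.
-- Another application of the Chinese remainder theorem gives b ≡ (A_p B⁻¹)⁻¹ a_p modulo p^(v_p(det B)),
-- which makes a_p - A_p B⁻¹ b divisible by det B in ℤ_p; then η(B, b) lies in the class of α.

module Submission where

open import Defs
open import Data.Product using (Σ; ∃₂; _×_; _,_; proj₁; proj₂)
open import Data.Nat as ℕ using (ℕ; zero; suc)
import Data.Nat.Properties as ℕP
open import Data.Nat.Primality using (Prime; prime?; prime⇒irreducible; prime⇒nonZero; prime⇒nonTrivial)
import Data.Nat.Divisibility as ℕD
import Data.Nat.Coprimality as ℕC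
import Data.Nat.GCD as ℕG
open import Data.Nat.Primality.Factorisation using (factorise)
open import Data.Nat.ListAction using (product)
open import Data.List using ([]; _∷_)
open import Data.List.Relation.Unary.All using (_∷_)
open import Data.Integer as ℤ using (ℤ; +_; -[1+_]; _+_; _*_; _-_; -_; 0ℤ; 1ℤ; ∣_∣)
import Data.Integer.Properties as ℤP
open import Data.Integer.Divisibility.Signed
open _∣_ using (equality)
open import Data.Integer.Tactic.RingSolver using (solve-∀)
open import Relation.Binary.PropositionalEquality
open import Relation.Nullary using (¬_; yes; no)
open import Data.Empty using (⊥-elim)
open import Data.Sum using (_⊎_; inj₁; inj₂)

infixr 8 _^ℤ_
_^ℤ_ : ℕ → ℕ → ℤ
p ^ℤ n = + (p ℕ.^ n)

^ℤ-+ : ∀ p i j → p ^ℤ (i ℕ.+ j) ≡ p ^ℤ i * p ^ℤ j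
^ℤ-+ p i j = trans (cong +_ (ℕP.^-distribˡ-+-* p i j)) (ℤP.pos-* (p ℕ.^ i) (p ℕ.^ j))

^ℤ-suc : ∀ p n → p ^ℤ suc n ≡ + p * p ^ℤ n
^ℤ-suc p n = ℤP.pos-* p (p ℕ.^ n)

^ℤ-1 : ∀ p → p ^ℤ 1 ≡ + p
^ℤ-1 p = cong +_ (ℕP.*-identityʳ p)

^ℤ-∣-^ℤ : ∀ p {i j} → i ℕ.≤ j → p ^ℤ i ∣ p ^ℤ j
^ℤ-∣-^ℤ p {i} i≤j with ℕP.m≤n⇒∃[o]m+o≡n i≤j
... | o , refl = divides (p ^ℤ o) (trans (^ℤ-+ p i o) (ℤP.*-comm (p ^ℤ i) (p ^ℤ o)))

^ℤ-∣-weaken : ∀ {p i j x} → i ℕ.≤ j → p ^ℤ j ∣ x → p ^ℤ i ∣ x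
^ℤ-∣-weaken {p} i≤j = ∣-trans (^ℤ-∣-^ℤ p i≤j)

1∣n : ∀ n → 1ℤ ∣ n
1∣n n = divides n (sym (ℤP.*-identityʳ n))

n∣0 : ∀ n → n ∣ 0ℤ
n∣0 n = divides 0ℤ refl

n∣m*n : ∀ n m → n ∣ m * n
n∣m*n n m = divides m refl

n∣n*m : ∀ n m → n ∣ n * m
n∣n*m n m = divides m (ℤP.*-comm n m)

∣-subst : ∀ {m x y} → m ∣ x → x ≡ y → m ∣ y
∣-subst h refl = h

mod-refl : ∀ m x → m ∣ x - x
mod-refl m x = ∣-subst (n∣0 m) (sym (ℤP.+-inverseʳ x))

≡⇒mod : ∀ {m x y} → x ≡ y → m ∣ x - y
≡⇒mod {m} {x} refl = mod-refl m x

mod-sym : ∀ {m} x y → m ∣ x - y → m ∣ y - x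
mod-sym x y h = ∣-subst (∣m⇒∣-m h) (negate-diff x y)
  where negate-diff : ∀ x y → - (x - y) ≡ y - x
        negate-diff = solve-∀

mod-trans : ∀ {m} x y z → m ∣ x - y → m ∣ y - z → m ∣ x - z
mod-trans x y z h₁ h₂ = ∣-subst (∣m∣n⇒∣m+n h₁ h₂) (telescope x y z)
  where telescope : ∀ x y z → (x - y) + (y - z) ≡ x - z
        telescope = solve-∀

mod⇒∣ : ∀ {m x y} → m ∣ x - y → m ∣ x → m ∣ y
mod⇒∣ {m} {x} {y} h hx = ∣-subst (∣m∣n⇒∣m-n hx h) (cancel x y)
  where cancel : ∀ x y → x - (x - y) ≡ y
        cancel = solve-∀

-- Bézout coprimality and primes

Coprime : ℤ → ℤ → Set
Coprime x y = ∃₂ λ s r → s * x + r * y ≡ 1ℤ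

coprime-sym : ∀ {x y} → Coprime x y → Coprime y x
coprime-sym {x} {y} (s , r , eq) = r , s , trans (ℤP.+-comm (r * y) (s * x)) eq

coprime-1 : ∀ x → Coprime x 1ℤ
coprime-1 x = 0ℤ , 1ℤ , refl

coprime-*ʳ : ∀ {x y z} → Coprime x y → Coprime x z → Coprime x (y * z)
coprime-*ʳ {x} {y} {z} (s , r , eq₁) (s′ , r′ , eq₂) =
  s * s′ * x + s * r′ * z + r * y * s′ , r * r′ ,
  trans (expand x y z s r s′ r′) (cong₂ _*_ eq₁ eq₂)
  where expand : ∀ x y z s r s′ r′ →
          (s * s′ * x + s * r′ * z + r * y * s′) * x + r * r′ * (y * z)
          ≡ (s * x + r * y) * (s′ * x + r′ * z)
        expand = solve-∀

coprime-*ˡ : ∀ {x y z} → Coprime x z → Coprime y z → Coprime (x * y) z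
coprime-*ˡ h₁ h₂ = coprime-sym (coprime-*ʳ (coprime-sym h₁) (coprime-sym h₂))

coprime-^ℤ : ∀ {p y} n → Coprime (+ p) y → Coprime (p ^ℤ n) y
coprime-^ℤ zero h = 1ℤ , 0ℤ , refl
coprime-^ℤ {p} {y} (suc n) h =
  subst (λ t → Coprime t y) (sym (^ℤ-suc p n)) (coprime-*ˡ h (coprime-^ℤ n h))

coprime-*⇒coprime : ∀ {x y z} → Coprime x (y * z) → Coprime x y
coprime-*⇒coprime {x} {y} {z} (s , r , eq) = s , r * z , trans (reassoc s x r y z) eq
  where reassoc : ∀ s x r y z → s * x + r * z * y ≡ s * x + r * (y * z)
        reassoc = solve-∀

coprime-divisor : ∀ {m x y} → Coprime m x → m ∣ x * y → m ∣ y
coprime-divisor {m} {x} {y} (s , r , eq) h =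
  ∣-subst (∣m∣n⇒∣m+n (∣n⇒∣m*n (y * s) (n∣m*n m 1ℤ)) (∣n⇒∣m*n r h))
          (trans (factor y s m r x) (trans (cong (y *_) eq) (ℤP.*-identityʳ y)))
  where factor : ∀ y s m r x → y * s * (1ℤ * m) + r * (x * y) ≡ y * (s * m + r * x)
        factor = solve-∀

coprime-resp-mod : ∀ {m x y} → Coprime m x → m ∣ y - x → Coprime m y
coprime-resp-mod {m} {x} {y} (s , r , eq) (divides t y-x≡tm) = s - r * t , r ,
  (begin
    (s - r * t) * m + r * y                ≡⟨ regroup s m r t x y ⟩
    s * m + r * x + r * ((y - x) - t * m)  ≡⟨ cong (λ u → s * m + r * x + r * (u - t * m)) y-x≡tm ⟩
    s * m + r * x + r * (t * m - t * m)    ≡⟨ cancel (s * m + r * x) r (t * m) ⟩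
    s * m + r * x                          ≡⟨ eq ⟩
    1ℤ                                     ∎)
  where
  open ≡-Reasoning
  regroup : ∀ s m r t x y → (s - r * t) * m + r * y ≡ s * m + r * x + r * ((y - x) - t * m)
  regroup = solve-∀
  cancel : ∀ a r u → a + r * (u - u) ≡ a
  cancel = solve-∀

≡1-mod⇒coprime : ∀ {m z} → m ∣ z - 1ℤ → Coprime m z
≡1-mod⇒coprime = coprime-resp-mod (coprime-1 _)

coprime-abs : ∀ {x} y → Coprime x (+ ∣ y ∣) → Coprime x y
coprime-abs (+ n) h = h
coprime-abs {x} -[1+ n ] (s , r , eq) = s , - r , trans (neg-neg s x r (+ suc n)) eq
  where neg-neg : ∀ s x r z → s * x + (- r) * (- z) ≡ s * x + r * z
        neg-neg = solve-∀

coprimeℕ⇒coprime : ∀ {m n} → ℕC.Coprime m n → Coprime (+ m) (+ n)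
coprimeℕ⇒coprime {m} {n} c with ℕC.coprime-Bézout c
... | ℕG.Bézout.+- x y eq = + x , - + y , lift (+ x) (+ m) (+ y) (+ n) (cast eq)
  where
  cast : 1 ℕ.+ y ℕ.* n ≡ x ℕ.* m → 1ℤ + + y * + n ≡ + x * + m
  cast e = trans (cong (λ u → 1ℤ + u) (sym (ℤP.pos-* y n))) (trans (cong +_ e) (ℤP.pos-* x m))
  lift : ∀ a b c d → 1ℤ + c * d ≡ a * b → a * b + - c * d ≡ 1ℤ
  lift a b c d e = trans (cong (_+ - c * d) (sym e)) (cancel c d)
    where cancel : ∀ c d → 1ℤ + c * d + - c * d ≡ 1ℤ
          cancel = solve-∀
... | ℕG.Bézout.-+ x y eq = - + x , + y , lift (+ x) (+ m) (+ y) (+ n) (cast eq)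
  where
  cast : 1 ℕ.+ x ℕ.* m ≡ y ℕ.* n → 1ℤ + + x * + m ≡ + y * + n
  cast e = trans (cong (λ u → 1ℤ + u) (sym (ℤP.pos-* x m))) (trans (cong +_ e) (ℤP.pos-* y n))
  lift : ∀ a b c d → 1ℤ + a * b ≡ c * d → - a * b + c * d ≡ 1ℤ
  lift a b c d e = trans (cong (λ u → - a * b + u) (sym e)) (cancel a b)
    where cancel : ∀ a b → - a * b + (1ℤ + a * b) ≡ 1ℤ
          cancel = solve-∀

prime≥2 : ∀ {p} → Prime p → 2 ℕ.≤ p
prime≥2 {p} pp = ℕ.nonTrivial⇒n>1 p {{prime⇒nonTrivial pp}}

^-nonZero : ∀ {p} → Prime p → ∀ n → ℕ.NonZero (p ℕ.^ n)
^-nonZero {p} pp n = ℕP.m^n≢0 p n {{prime⇒nonZero pp}}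

^ℤ-nonZero : ∀ {p} → Prime p → ∀ n → ℤ.NonZero (p ^ℤ n)
^ℤ-nonZero = ^-nonZero

prime∤⇒coprime : ∀ {p} y → Prime p → ¬ (+ p ∣ y) → Coprime (+ p) y
prime∤⇒coprime {p} y pp p∤y = coprime-abs y (coprimeℕ⇒coprime coprime)
  where
  coprime : ℕC.Coprime p ∣ y ∣
  coprime {d} (d∣p , d∣y) with prime⇒irreducible pp d∣p
  ... | inj₁ d≡1 = d≡1
  ... | inj₂ refl = ⊥-elim (p∤y (∣ᵤ⇒∣ d∣y))

coprime⇒∤ : ∀ {p x} → Prime p → Coprime (+ p) x → ¬ (+ p ∣ x)
coprime⇒∤ {p} pp (s , r , eq) (divides t refl) =
  ℕP.<⇒≱ (prime≥2 pp) (ℕD.∣⇒≤ (∣⇒∣ᵤ {+ p} {1ℤ} (divides (s + r * t) (trans (sym eq) (factor s r t (+ p))))))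
  where factor : ∀ s r t p → s * p + r * (t * p) ≡ (s + r * t) * p
        factor = solve-∀

distinct-primes-coprime : ∀ {p q} → Prime p → Prime q → p ≢ q → Coprime (+ p) (+ q)
distinct-primes-coprime {p} {q} pp pq p≢q = prime∤⇒coprime (+ q) pp (λ p∣q → p≢q (divisor≡ (∣⇒∣ᵤ p∣q)))
  where
  divisor≡ : p ℕD.∣ q → p ≡ q
  divisor≡ p∣q with prime⇒irreducible pq p∣q
  ... | inj₂ p≡q = p≡q
  ... | inj₁ refl = ⊥-elim (ℕP.<-irrefl refl (prime≥2 pp))

coprime-^ℤ-distinct : ∀ {p q} → Prime p → Prime q → p ≢ q → ∀ k → Coprime (+ p) (q ^ℤ k)
coprime-^ℤ-distinct pp pq p≢q k = coprime-sym (coprime-^ℤ k (coprime-sym (distinct-primes-coprime pp pq p≢q)))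

^ℤ-suc-∤ : ∀ {p} → Prime p → ∀ k → ¬ (p ^ℤ suc k ∣ p ^ℤ k)
^ℤ-suc-∤ {p} pp k h = ℕP.<⇒≱ (ℕP.^-monoʳ-< p (prime≥2 pp) (ℕP.n<1+n k)) (ℕD.∣⇒≤ {{^-nonZero pp k}} (∣⇒∣ᵤ h))

n<p^n : ∀ p → 2 ℕ.≤ p → ∀ n → n ℕ.< p ℕ.^ n
n<p^n p 2≤p zero = ℕ.s≤s ℕ.z≤n
n<p^n p 2≤p (suc n) = ℕP.<-≤-trans (ℕ.s≤s (n<p^n p 2≤p n)) (ℕP.^-monoʳ-< p 2≤p (ℕP.n<1+n n))

^ℤ-∣-abs⇒≡0 : ∀ {p} → Prime p → ∀ z → p ^ℤ ∣ z ∣ ∣ z → z ≡ 0ℤ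
^ℤ-∣-abs⇒≡0 {p} pp z h with z ℤP.≟ 0ℤ
... | yes z≡0 = z≡0
... | no z≢0 = ⊥-elim (ℕP.<⇒≱ (n<p^n p (prime≥2 pp) ∣ z ∣) (ℕD.∣⇒≤ {{ℤ.≢-nonZero z≢0}} (∣⇒∣ᵤ h)))

prime-divisor : ∀ n → 2 ℕ.≤ n → Σ ℕ λ p → Prime p × p ℕD.∣ n
prime-divisor (suc zero) (ℕ.s≤s ())
prime-divisor n@(suc (suc _)) _ with factorise n
... | record { factors = [] ; isFactorisation = () }
... | record { factors = p ∷ rest ; isFactorisation = eq ; factorsPrime = pp ∷ _ } =
  p , pp , ℕD.divides (product rest) (trans eq (ℕP.*-comm p (product rest)))

-- Local–global divisibility

PrimePowerDivisorsDivide : ℤ → ℤ → Set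
PrimePowerDivisorsDivide d M = ∀ p → Prime p → ∀ n → p ^ℤ n ∣ d → p ^ℤ n ∣ M

prime-powers⇒∣ : ∀ {d M} → d ≢ 0ℤ → PrimePowerDivisorsDivide d M → d ∣ M
prime-powers⇒∣ {d} = bounded ∣ d ∣ ℕP.≤-refl
  where
  bounded : ∀ f {d M} → ∣ d ∣ ℕ.≤ f → d ≢ 0ℤ → PrimePowerDivisorsDivide d M → d ∣ M
  bounded zero ∣d∣≤0 d≢0 _ = ⊥-elim (d≢0 (ℤP.∣i∣≡0⇒i≡0 (ℕP.n≤0⇒n≡0 ∣d∣≤0)))
  bounded (suc f) {d} {M} ∣d∣≤f d≢0 h with 2 ℕP.≤? ∣ d ∣
  ... | no ∣d∣<2 = ∣-trans m∣∣m∣ (subst (_∣ M) (cong +_ (sym ∣d∣≡1)) (1∣n M))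
    where
    ∣d∣≡1 : ∣ d ∣ ≡ 1
    ∣d∣≡1 with ∣ d ∣ in eq
    ... | zero = ⊥-elim (d≢0 (ℤP.∣i∣≡0⇒i≡0 eq))
    ... | suc zero = refl
    ... | suc (suc _) = ⊥-elim (∣d∣<2 (ℕ.s≤s (ℕ.s≤s ℕ.z≤n)))
  ... | yes 2≤∣d∣ with prime-divisor ∣ d ∣ 2≤∣d∣
  ... | p , pp , p∣d with ∣ᵤ⇒∣ {+ p} {d} p∣d | subst (_∣ M) (^ℤ-1 p) (h p pp 1 (subst (_∣ d) (sym (^ℤ-1 p)) (∣ᵤ⇒∣ p∣d)))
  ... | divides e refl | divides M′ refl = *-monoˡ-∣ (+ p) (bounded f ∣e∣≤f e≢0 h′)
    where
    instance
      p≢0 : ℤ.NonZero (+ p)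
      p≢0 = prime⇒nonZero pp
    e≢0 : e ≢ 0ℤ
    e≢0 refl = d≢0 refl
    ∣e∣≤f : ∣ e ∣ ℕ.≤ f
    ∣e∣≤f = ℕ.s≤s⁻¹ (ℕP.<-≤-trans (ℕP.<-≤-trans (ℕP.m<m*n ∣ e ∣ p {{ℤ.≢-nonZero e≢0}} (prime≥2 pp))
                                                 (ℕP.≤-reflexive (sym (ℤP.abs-* e (+ p))))) ∣d∣≤f)
    shift : ∀ {x} n → p ^ℤ n ∣ x → p ^ℤ suc n ∣ x * + p
    shift {x} n hx = subst (_∣ x * + p) (trans (ℤP.*-comm (p ^ℤ n) (+ p)) (sym (^ℤ-suc p n))) (*-monoˡ-∣ (+ p) hx)
    h′ : PrimePowerDivisorsDivide e M′
    h′ q pq n q^n∣e with q ℕP.≟ p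
    ... | yes refl = *-cancelʳ-∣ (+ p) (subst (_∣ M′ * + p) (trans (^ℤ-suc p n) (ℤP.*-comm (+ p) (p ^ℤ n)))
                                                (h p pp (suc n) (shift n q^n∣e)))
    ... | no q≢p = coprime-divisor (coprime-^ℤ n (distinct-primes-coprime pq pp q≢p))
                     (subst (q ^ℤ n ∣_) (ℤP.*-comm M′ (+ p)) (h q pq n (∣m⇒∣m*n (+ p) q^n∣e)))

-- p-adic integers

module _ {p : ℕ} where

  seq-+-mod : ∀ (x : ℤ[ p ]) k n → p ^ℤ n ∣ seq x (k ℕ.+ n) - seq x n
  seq-+-mod x zero n = mod-refl (p ^ℤ n) (seq x n)
  seq-+-mod x (suc k) n = mod-trans (seq x (suc (k ℕ.+ n))) (seq x (k ℕ.+ n)) (seq x n)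
    (^ℤ-∣-weaken (ℕP.m≤n+m n k) (coh x (k ℕ.+ n))) (seq-+-mod x k n)

  seq-mono-mod : ∀ (x : ℤ[ p ]) {i j} → i ℕ.≤ j → p ^ℤ i ∣ seq x j - seq x i
  seq-mono-mod x {i} i≤j with ℕP.m≤n⇒∃[o]m+o≡n i≤j
  ... | o , refl = subst (λ t → p ^ℤ i ∣ seq x t - seq x i) (ℕP.+-comm o i) (seq-+-mod x o i)

  seq-∣-stable : ∀ (x : ℤ[ p ]) {v m m′} → v ℕ.≤ m → v ℕ.≤ m′ → p ^ℤ v ∣ seq x m → p ^ℤ v ∣ seq x m′
  seq-∣-stable x {v} {m} {m′} v≤m v≤m′ h =
    mod⇒∣ (mod-trans (seq x m) (seq x v) (seq x m′) (seq-mono-mod x v≤m) (mod-sym (seq x m′) (seq x v) (seq-mono-mod x v≤m′))) h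

  coprime⇒unit : (x : ℤ[ p ]) → Coprime (+ p) (seq x 1) → UnitZp p x
  coprime⇒unit x x₁⊥p = padic inverse inverse-coh , inverse-spec
    where
    coprime-seq : ∀ n → Coprime (p ^ℤ suc n) (seq x (suc n))
    coprime-seq n = coprime-^ℤ (suc n) (coprime-resp-mod x₁⊥p
      (subst (_∣ seq x (suc n) - seq x 1) (^ℤ-1 p) (seq-mono-mod x (ℕ.s≤s ℕ.z≤n))))

    inverse : ℕ → ℤ
    inverse zero = 0ℤ
    inverse (suc n) = proj₁ (proj₂ (coprime-seq n))

    inverse-spec : ∀ n → p ^ℤ n ∣ seq x n * inverse n - 1ℤ
    inverse-spec zero = 1∣n _
    inverse-spec (suc n) =
      ∣-subst (∣m⇒∣-m (n∣m*n (p ^ℤ suc n) s)) (trans (rearrange s (p ^ℤ suc n) r (seq x (suc n))) (cong (λ t → seq x (suc n) * r - t) eq))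
      where
      s r : ℤ
      s = proj₁ (coprime-seq n)
      r = proj₁ (proj₂ (coprime-seq n))
      eq : s * p ^ℤ suc n + r * seq x (suc n) ≡ 1ℤ
      eq = proj₂ (proj₂ (coprime-seq n))
      rearrange : ∀ s P r X → - (s * P) ≡ X * r - (s * P + r * X)
      rearrange = solve-∀

    -- x_{n+1} (u_{n+2} - u_{n+1}) ≡ 0 modulo p^(n+1), and x_{n+1} is coprime to p^(n+1).
    inverse-coh : ∀ n → p ^ℤ n ∣ inverse (suc n) - inverse n
    inverse-coh zero = 1∣n _
    inverse-coh (suc n) = coprime-divisor (coprime-seq n) (∣-subst
      (∣m∣n⇒∣m-n (∣m∣n⇒∣m-n (^ℤ-∣-weaken {p} {suc n} {suc (suc n)} (ℕP.n≤1+n _) (inverse-spec (suc (suc n)))) (inverse-spec (suc n)))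
                 (∣m⇒∣m*n (inverse (suc (suc n))) (coh x (suc n))))
      (difference (seq x (suc n)) (seq x (suc (suc n))) (inverse (suc n)) (inverse (suc (suc n)))))
      where difference : ∀ a a′ r r′ → ((a′ * r′ - 1ℤ) - (a * r - 1ℤ)) - (a′ - a) * r′ ≡ a * (r′ - r)
            difference = solve-∀

module _ {p : ℕ} (pp : Prime p) where

  ^-quotient : ∀ v (z : ℤ[ p ]) → (∀ n → p ^ℤ v ∣ seq z (n ℕ.+ v)) →
               Σ ℤ[ p ] λ q → ∀ n → p ^ℤ v * seq q n ≡ seq z (n ℕ.+ v)
  ^-quotient v z h = padic q q-coh , λ n → trans (ℤP.*-comm (p ^ℤ v) (q n)) (sym (q-spec n))
    where
    q : ℕ → ℤ
    q n = quotient (h n)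
    q-spec : ∀ n → seq z (n ℕ.+ v) ≡ q n * p ^ℤ v
    q-spec n = _∣_.equality (h n)
    q-coh : ∀ n → p ^ℤ n ∣ q (suc n) - q n
    q-coh n = *-cancelʳ-∣ (p ^ℤ v) {{^ℤ-nonZero pp v}}
      (∣-subst (subst (_∣ _) (^ℤ-+ p n v) (coh z (n ℕ.+ v)))
               (trans (cong₂ _-_ (q-spec (suc n)) (q-spec n)) (factor (q (suc n)) (q n) (p ^ℤ v))))
      where factor : ∀ a b c → a * c - b * c ≡ (a - b) * c
            factor = solve-∀

  record CommonValuation (f : ℕ) (a c : ℤ) : Set where
    field
      j : ℕ
      a′ c′ : ℤ
      a≡ : a ≡ p ^ℤ j * a′
      c≡ : c ≡ p ^ℤ j * c′
      a′⊥p⊎c′⊥p : Coprime (+ p) a′ ⊎ Coprime (+ p) c′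
      j<f : j ℕ.< f

  common-valuation : ∀ f a c → ¬ ((p ^ℤ f ∣ a) × (p ^ℤ f ∣ c)) → CommonValuation f a c
  common-valuation zero a c h = ⊥-elim (h (1∣n a , 1∣n c))
  common-valuation (suc f) a c h with + p ∣? a | + p ∣? c
  ... | no p∤a | _ = record { j = 0 ; a≡ = sym (ℤP.*-identityˡ a) ; c≡ = sym (ℤP.*-identityˡ c)
                            ; a′⊥p⊎c′⊥p = inj₁ (prime∤⇒coprime a pp p∤a) ; j<f = ℕ.s≤s ℕ.z≤n }
  ... | yes _ | no p∤c = record { j = 0 ; a≡ = sym (ℤP.*-identityˡ a) ; c≡ = sym (ℤP.*-identityˡ c)
                                ; a′⊥p⊎c′⊥p = inj₂ (prime∤⇒coprime c pp p∤c) ; j<f = ℕ.s≤s ℕ.z≤n }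
  ... | yes (divides a₁ refl) | yes (divides c₁ refl) = record
    { j = suc j ; a≡ = shift a≡ ; c≡ = shift c≡ ; a′⊥p⊎c′⊥p = a′⊥p⊎c′⊥p ; j<f = ℕ.s≤s j<f }
    where
    raise : ∀ {z} → p ^ℤ f ∣ z → p ^ℤ suc f ∣ z * + p
    raise hz = subst (_∣ _) (trans (ℤP.*-comm (p ^ℤ f) (+ p)) (sym (^ℤ-suc p f))) (*-monoˡ-∣ (+ p) hz)
    open CommonValuation (common-valuation f a₁ c₁ λ (d₁ , d₂) → h (raise d₁ , raise d₂))
    shift : ∀ {z z′} → z ≡ p ^ℤ j * z′ → z * + p ≡ p ^ℤ suc j * z′
    shift {z′ = z′} refl = trans (rotate (p ^ℤ j) z′ (+ p)) (cong (_* z′) (sym (^ℤ-suc p j)))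
      where rotate : ∀ a b c → a * b * c ≡ c * a * b
            rotate = solve-∀

  record Valuation (f : ℕ) (a : ℤ) : Set where
    field
      v : ℕ
      a′ : ℤ
      a≡ : a ≡ p ^ℤ v * a′
      a′⊥p : Coprime (+ p) a′
      v<f : v ℕ.< f

  valuation : ∀ f a → ¬ (p ^ℤ f ∣ a) → Valuation f a
  valuation f a h with common-valuation f a 0ℤ (λ (d , _) → h d)
  ... | record { j = j ; a′ = a′ ; c′ = c′ ; a≡ = a≡ ; c≡ = c≡ ; a′⊥p⊎c′⊥p = inj₁ a′⊥p ; j<f = j<f } =
    record { v = j ; a′ = a′ ; a≡ = a≡ ; a′⊥p = a′⊥p ; v<f = j<f }
  ... | record { j = j ; c′ = c′ ; c≡ = c≡ ; a′⊥p⊎c′⊥p = inj₂ c′⊥p } =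
    ⊥-elim (coprime⇒∤ pp c′⊥p (subst (+ p ∣_) (sym c′≡0) (n∣0 (+ p))))
    where
    c′≡0 : c′ ≡ 0ℤ
    c′≡0 = ℤP.*-cancelˡ-≡ (p ^ℤ j) c′ 0ℤ {{^ℤ-nonZero pp j}} (trans (sym c≡) (sym (ℤP.*-zeroʳ (p ^ℤ j))))

  ^ℤ-∣-unit-multiple⇒≤ : ∀ {j v e z} → p ^ℤ j ∣ z → z ≡ p ^ℤ v * e → Coprime (+ p) e → j ℕ.≤ v
  ^ℤ-∣-unit-multiple⇒≤ {j} {v} {e} {z} p^j∣z z≡ e⊥p with j ℕP.≤? v
  ... | yes j≤v = j≤v
  ... | no j≰v = ⊥-elim (coprime⇒∤ pp e⊥p (*-cancelˡ-∣ (p ^ℤ v) {{^ℤ-nonZero pp v}} p^v*p∣p^v*e))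
    where
    p^v*p∣p^v*e : p ^ℤ v * + p ∣ p ^ℤ v * e
    p^v*p∣p^v*e = subst₂ _∣_ (trans (^ℤ-suc p v) (ℤP.*-comm (+ p) (p ^ℤ v))) z≡ (^ℤ-∣-weaken (ℕP.≰⇒> j≰v) p^j∣z)

-- Well-definedness and injectivity

≈p-refl : ∀ {p} (x : ℤ[ p ]) → x ≈p x
≈p-refl {p} x n = mod-refl (p ^ℤ n) (seq x n)

≈H-refl : ∀ {p} (α : M2 ℤ[ p ] × V2 ℤ[ p ]) → EqsP._≈H_ p α α
≈H-refl (mat a b c d , vec x y) = (≈p-refl a , ≈p-refl b , ≈p-refl c , ≈p-refl d) , (≈p-refl x , ≈p-refl y)

η-respects-∼Γ : (β β′ : ΔH) → β ∼Γ β′ → η (proj₁ β) ∼Γ̂ η (proj₁ β′)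
η-respects-∼Γ ((A , a) , _) (.(OpsZ._∘H_ (C , c) (A , a)) , _) (((C , c) , u , detC*u≡1) , refl) =
  (λ p _ → (ιM C , ιV c) , ι u , λ n → ≡⇒mod detC*u≡1) , λ p _ → ≈H-refl (OpsP._∘H_ p (ιM C , ιV c) (ιM A , ιV a))

LocallyDivisible : ℕ → ℤ → ℤ → Set
LocallyDivisible p D M = Σ (ℕ → ℤ) λ c → ∀ n → p ^ℤ n ∣ D * c n - M

locally-divisible⇒∣ : ∀ {D M} → D ≢ 0ℤ → (∀ p → Prime p → LocallyDivisible p D M) → D ∣ M
locally-divisible⇒∣ D≢0 h = prime-powers⇒∣ D≢0 λ p pp n p^n∣D →
  mod⇒∣ (proj₂ (h p pp) n) (∣m⇒∣m*n (proj₁ (h p pp) n) p^n∣D)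

-- If p ∣ y, then D (1 - y u) ≡ 0 modulo every p^k with 1 - y u a unit, so every p^k divides D.
unit-multiple⇒∤ : ∀ {p D y} → Prime p → D ≢ 0ℤ → (x u : ℕ → ℤ) →
  (∀ k → p ^ℤ k ∣ D * x k - D * y) → (∀ k → p ^ℤ k ∣ x k * u k - 1ℤ) → ¬ (+ p ∣ y)
unit-multiple⇒∤ {p} {D} pp D≢0 x u Dx≡Dy xu≡1 (divides t refl) = D≢0 (^ℤ-∣-abs⇒≡0 pp D (p^k∣D ∣ D ∣))
  where
  p^k∣D : ∀ k → p ^ℤ k ∣ D
  p^k∣D k = coprime-divisor (coprime-^ℤ k coprime)
    (∣-subst (∣m∣n⇒∣m-n (∣m⇒∣m*n (u k) (Dx≡Dy k)) (∣n⇒∣m*n D (xu≡1 k))) (expand D (x k) (t * + p) (u k)))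
    where
    coprime : Coprime (+ p) (1ℤ - t * + p * u k)
    coprime = t * u k , 1ℤ , cancel t (u k) (+ p)
      where cancel : ∀ t u p → t * u * p + 1ℤ * (1ℤ - t * p * u) ≡ 1ℤ
            cancel = solve-∀
    expand : ∀ D x y u → (D * x - D * y) * u - D * (x * u - 1ℤ) ≡ (1ℤ - y * u) * D
    expand = solve-∀

mat-cong : ∀ {a b c d a′ b′ c′ d′ : ℤ} → a ≡ a′ → b ≡ b′ → c ≡ c′ → d ≡ d′ → mat a b c d ≡ mat a′ b′ c′ d′
mat-cong refl refl refl refl = refl

vec-cong : ∀ {a b a′ b′ : ℤ} → a ≡ a′ → b ≡ b′ → vec a b ≡ vec a′ b′
vec-cong refl refl = refl

module Injectivity (a₁₁ a₁₂ a₂₁ a₂₂ x y b₁₁ b₁₂ b₂₁ b₂₂ x′ y′ : ℤ) where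

  -- M = B adj(A) and W = d b′ - M a, so that γ = (M / d , W / d²) is the candidate with γ β = β′.
  d M₁₁ M₁₂ M₂₁ M₂₂ W₁ W₂ detM : ℤ
  d = a₁₁ * a₂₂ - a₁₂ * a₂₁
  M₁₁ = b₁₁ * a₂₂ - b₁₂ * a₂₁
  M₁₂ = b₁₂ * a₁₁ - b₁₁ * a₁₂
  M₂₁ = b₂₁ * a₂₂ - b₂₂ * a₂₁
  M₂₂ = b₂₂ * a₁₁ - b₂₁ * a₁₂
  W₁ = d * x′ - (M₁₁ * x + M₁₂ * y)
  W₂ = d * y′ - (M₂₁ * x + M₂₂ * y)
  detM = M₁₁ * M₂₂ - M₁₂ * M₂₁

  record LocalQuotient (p : ℕ) : Set where
    field
      c₁₁ c₁₂ c₂₁ c₂₂ c₁ c₂ u : ℕ → ℤ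
      dc₁₁≡M₁₁ : ∀ n → p ^ℤ n ∣ d * c₁₁ n - M₁₁
      dc₁₂≡M₁₂ : ∀ n → p ^ℤ n ∣ d * c₁₂ n - M₁₂
      dc₂₁≡M₂₁ : ∀ n → p ^ℤ n ∣ d * c₂₁ n - M₂₁
      dc₂₂≡M₂₂ : ∀ n → p ^ℤ n ∣ d * c₂₂ n - M₂₂
      d²c₁≡W₁ : ∀ n → p ^ℤ n ∣ d * d * c₁ n - W₁
      d²c₂≡W₂ : ∀ n → p ^ℤ n ∣ d * d * c₂ n - W₂
      d²detC≡detM : ∀ n → p ^ℤ n ∣ d * d * (c₁₁ n * c₂₂ n - c₁₂ n * c₂₁ n) - detM
      detC-unit : ∀ n → p ^ℤ n ∣ (c₁₁ n * c₂₂ n - c₁₂ n * c₂₁ n) * u n - 1ℤ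

  private
    row-first : ∀ a₁₁ a₁₂ a₂₁ a₂₂ b₁ b₂ c₁ c₂ →
      (c₁ * a₁₁ + c₂ * a₂₁ - b₁) * a₂₂ - (c₁ * a₁₂ + c₂ * a₂₂ - b₂) * a₂₁
      ≡ (a₁₁ * a₂₂ - a₁₂ * a₂₁) * c₁ - (b₁ * a₂₂ - b₂ * a₂₁)
    row-first = solve-∀
    row-second : ∀ a₁₁ a₁₂ a₂₁ a₂₂ b₁ b₂ c₁ c₂ →
      (c₁ * a₁₂ + c₂ * a₂₂ - b₂) * a₁₁ - (c₁ * a₁₁ + c₂ * a₂₁ - b₁) * a₁₂
      ≡ (a₁₁ * a₂₂ - a₁₂ * a₂₁) * c₂ - (b₂ * a₁₁ - b₁ * a₁₂)
    row-second = solve-∀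
    vector-part : ∀ d c₁ c₂ M₁ M₂ x y v x′ →
      d * (c₁ * x + c₂ * y + d * v - x′) - ((d * c₁ - M₁) * x + (d * c₂ - M₂) * y)
      ≡ d * d * v - (d * x′ - (M₁ * x + M₂ * y))
    vector-part = solve-∀
    determinant : ∀ d c₁₁ c₁₂ c₂₁ c₂₂ M₁₁ M₁₂ M₂₁ M₂₂ →
      (d * c₁₁ - M₁₁) * (d * c₂₂) + M₁₁ * (d * c₂₂ - M₂₂) - (d * c₁₂ - M₁₂) * (d * c₂₁) - M₁₂ * (d * c₂₁ - M₂₁)
      ≡ d * d * (c₁₁ * c₂₂ - c₁₂ * c₂₁) - (M₁₁ * M₂₂ - M₁₂ * M₂₁)
    determinant = solve-∀

  local-quotient : ∀ {p} (pp : Prime p) (γ : Γp p) →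
    EqsP._≈H_ p (OpsP._∘H_ p (proj₁ γ) (η (mat a₁₁ a₁₂ a₂₁ a₂₂ , vec x y) p pp))
                (η (mat b₁₁ b₁₂ b₂₁ b₂₂ , vec x′ y′) p pp) →
    LocalQuotient p
  local-quotient {p} pp ((mat C₁₁ C₁₂ C₂₁ C₂₂ , vec v₁ v₂) , u , detC*u≡1)
                        ((CA₁₁≡ , CA₁₂≡ , CA₂₁≡ , CA₂₂≡) , (Ca≡₁ , Ca≡₂)) = record
    { c₁₁ = seq C₁₁ ; c₁₂ = seq C₁₂ ; c₂₁ = seq C₂₁ ; c₂₂ = seq C₂₂ ; c₁ = seq v₁ ; c₂ = seq v₂ ; u = seq u
    ; dc₁₁≡M₁₁ = dc₁₁≡ ; dc₁₂≡M₁₂ = dc₁₂≡ ; dc₂₁≡M₂₁ = dc₂₁≡ ; dc₂₂≡M₂₂ = dc₂₂≡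
    ; d²c₁≡W₁ = λ n → ∣-subst (∣m∣n⇒∣m-n (∣n⇒∣m*n d (Ca≡₁ n)) (∣m∣n⇒∣m+n (∣m⇒∣m*n x (dc₁₁≡ n)) (∣m⇒∣m*n y (dc₁₂≡ n))))
                                (vector-part d (seq C₁₁ n) (seq C₁₂ n) M₁₁ M₁₂ x y (seq v₁ n) x′)
    ; d²c₂≡W₂ = λ n → ∣-subst (∣m∣n⇒∣m-n (∣n⇒∣m*n d (Ca≡₂ n)) (∣m∣n⇒∣m+n (∣m⇒∣m*n x (dc₂₁≡ n)) (∣m⇒∣m*n y (dc₂₂≡ n))))
                                (vector-part d (seq C₂₁ n) (seq C₂₂ n) M₂₁ M₂₂ x y (seq v₂ n) y′)
    ; d²detC≡detM = λ n → ∣-subst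
        (∣m∣n⇒∣m-n (∣m∣n⇒∣m-n (∣m∣n⇒∣m+n (∣m⇒∣m*n _ (dc₁₁≡ n)) (∣n⇒∣m*n M₁₁ (dc₂₂≡ n))) (∣m⇒∣m*n _ (dc₁₂≡ n)))
                   (∣n⇒∣m*n M₁₂ (dc₂₁≡ n)))
        (determinant d (seq C₁₁ n) (seq C₁₂ n) (seq C₂₁ n) (seq C₂₂ n) M₁₁ M₁₂ M₂₁ M₂₂)
    ; detC-unit = detC*u≡1 }
    where
    dc₁₁≡ : ∀ n → p ^ℤ n ∣ d * seq C₁₁ n - M₁₁
    dc₁₁≡ n = ∣-subst (∣m∣n⇒∣m-n (∣m⇒∣m*n a₂₂ (CA₁₁≡ n)) (∣m⇒∣m*n a₂₁ (CA₁₂≡ n)))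
                      (row-first a₁₁ a₁₂ a₂₁ a₂₂ b₁₁ b₁₂ (seq C₁₁ n) (seq C₁₂ n))
    dc₁₂≡ : ∀ n → p ^ℤ n ∣ d * seq C₁₂ n - M₁₂
    dc₁₂≡ n = ∣-subst (∣m∣n⇒∣m-n (∣m⇒∣m*n a₁₁ (CA₁₂≡ n)) (∣m⇒∣m*n a₁₂ (CA₁₁≡ n)))
                      (row-second a₁₁ a₁₂ a₂₁ a₂₂ b₁₁ b₁₂ (seq C₁₁ n) (seq C₁₂ n))
    dc₂₁≡ : ∀ n → p ^ℤ n ∣ d * seq C₂₁ n - M₂₁
    dc₂₁≡ n = ∣-subst (∣m∣n⇒∣m-n (∣m⇒∣m*n a₂₂ (CA₂₁≡ n)) (∣m⇒∣m*n a₂₁ (CA₂₂≡ n)))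
                      (row-first a₁₁ a₁₂ a₂₁ a₂₂ b₂₁ b₂₂ (seq C₂₁ n) (seq C₂₂ n))
    dc₂₂≡ : ∀ n → p ^ℤ n ∣ d * seq C₂₂ n - M₂₂
    dc₂₂≡ n = ∣-subst (∣m∣n⇒∣m-n (∣m⇒∣m*n a₁₁ (CA₂₂≡ n)) (∣m⇒∣m*n a₁₂ (CA₂₁≡ n)))
                      (row-second a₁₁ a₁₂ a₂₁ a₂₂ b₂₁ b₂₂ (seq C₂₁ n) (seq C₂₂ n))

η-injective : (β β′ : ΔH) → η (proj₁ β) ∼Γ̂ η (proj₁ β′) → β ∼Γ β′
η-injective ((mat a₁₁ a₁₂ a₂₁ a₂₂ , vec x y) , d≢0) ((mat b₁₁ b₁₂ b₂₁ b₂₂ , vec x′ y′) , d′≢0) (γ̂ , γ̂β≈β′) =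
  ((mat C₁₁ C₁₂ C₂₁ C₂₂ , vec c₁ c₂) , u , detC*u≡1) , cong₂ _,_ CA≡B Ca+dc≡b′
  where
  open Injectivity a₁₁ a₁₂ a₂₁ a₂₂ x y b₁₁ b₁₂ b₂₁ b₂₂ x′ y′
  module L p pp = LocalQuotient (local-quotient pp (γ̂ p pp) (γ̂β≈β′ p pp))

  instance
    d-nonZero : ℤ.NonZero d
    d-nonZero = ℤ.≢-nonZero d≢0

  d²≢0 : d * d ≢ 0ℤ
  d²≢0 d²≡0 = ℕ.≢-nonZero⁻¹ ∣ d * d ∣ {{ℤP.i*j≢0 d d}} (cong ∣_∣ d²≡0)

  d∣M₁₁ : d ∣ M₁₁
  d∣M₁₁ = locally-divisible⇒∣ d≢0 λ p pp → L.c₁₁ p pp , L.dc₁₁≡M₁₁ p pp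
  d∣M₁₂ : d ∣ M₁₂
  d∣M₁₂ = locally-divisible⇒∣ d≢0 λ p pp → L.c₁₂ p pp , L.dc₁₂≡M₁₂ p pp
  d∣M₂₁ : d ∣ M₂₁
  d∣M₂₁ = locally-divisible⇒∣ d≢0 λ p pp → L.c₂₁ p pp , L.dc₂₁≡M₂₁ p pp
  d∣M₂₂ : d ∣ M₂₂
  d∣M₂₂ = locally-divisible⇒∣ d≢0 λ p pp → L.c₂₂ p pp , L.dc₂₂≡M₂₂ p pp

  C₁₁ C₁₂ C₂₁ C₂₂ : ℤ
  C₁₁ = quotient d∣M₁₁
  C₁₂ = quotient d∣M₁₂
  C₂₁ = quotient d∣M₂₁
  C₂₂ = quotient d∣M₂₂

  entry : ∀ C D {M N} a b t → M ≡ C * d → N ≡ D * d → M * a + N * b ≡ d * t → C * a + D * b ≡ t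
  entry C D a b t refl refl eq = ℤP.*-cancelˡ-≡ d _ _ (trans (distribute d C D a b) eq)
    where distribute : ∀ d C D a b → d * (C * a + D * b) ≡ C * d * a + D * d * b
          distribute = solve-∀

  adjugate-first : ∀ a₁₁ a₁₂ a₂₁ a₂₂ b₁ b₂ →
    (b₁ * a₂₂ - b₂ * a₂₁) * a₁₁ + (b₂ * a₁₁ - b₁ * a₁₂) * a₂₁ ≡ (a₁₁ * a₂₂ - a₁₂ * a₂₁) * b₁
  adjugate-first = solve-∀
  adjugate-second : ∀ a₁₁ a₁₂ a₂₁ a₂₂ b₁ b₂ →
    (b₁ * a₂₂ - b₂ * a₂₁) * a₁₂ + (b₂ * a₁₁ - b₁ * a₁₂) * a₂₂ ≡ (a₁₁ * a₂₂ - a₁₂ * a₂₁) * b₂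
  adjugate-second = solve-∀

  CA≡B : OpsZ._·_ (mat C₁₁ C₁₂ C₂₁ C₂₂) (mat a₁₁ a₁₂ a₂₁ a₂₂) ≡ mat b₁₁ b₁₂ b₂₁ b₂₂
  CA≡B = mat-cong (entry C₁₁ C₁₂ a₁₁ a₂₁ b₁₁ (equality d∣M₁₁) (equality d∣M₁₂) (adjugate-first a₁₁ a₁₂ a₂₁ a₂₂ b₁₁ b₁₂))
                  (entry C₁₁ C₁₂ a₁₂ a₂₂ b₁₂ (equality d∣M₁₁) (equality d∣M₁₂) (adjugate-second a₁₁ a₁₂ a₂₁ a₂₂ b₁₁ b₁₂))
                  (entry C₂₁ C₂₂ a₁₁ a₂₁ b₂₁ (equality d∣M₂₁) (equality d∣M₂₂) (adjugate-first a₁₁ a₁₂ a₂₁ a₂₂ b₂₁ b₂₂))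
                  (entry C₂₁ C₂₂ a₁₂ a₂₂ b₂₂ (equality d∣M₂₁) (equality d∣M₂₂) (adjugate-second a₁₁ a₁₂ a₂₁ a₂₂ b₂₁ b₂₂))

  d∣b′-Ca : ∀ C D {M N x″} → M ≡ C * d → N ≡ D * d → d * d ∣ d * x″ - (M * x + N * y) → d ∣ x″ - (C * x + D * y)
  d∣b′-Ca C D {x″ = x″} refl refl h = *-cancelˡ-∣ d (∣-subst h (factor d x″ C D x y))
    where factor : ∀ d x″ C D x y → d * x″ - (C * d * x + D * d * y) ≡ d * (x″ - (C * x + D * y))
          factor = solve-∀

  d∣b′₁-Ca : d ∣ x′ - (C₁₁ * x + C₁₂ * y)
  d∣b′₁-Ca = d∣b′-Ca C₁₁ C₁₂ (equality d∣M₁₁) (equality d∣M₁₂) (locally-divisible⇒∣ d²≢0 λ p pp → L.c₁ p pp , L.d²c₁≡W₁ p pp)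
  d∣b′₂-Ca : d ∣ y′ - (C₂₁ * x + C₂₂ * y)
  d∣b′₂-Ca = d∣b′-Ca C₂₁ C₂₂ (equality d∣M₂₁) (equality d∣M₂₂) (locally-divisible⇒∣ d²≢0 λ p pp → L.c₂ p pp , L.d²c₂≡W₂ p pp)

  c₁ c₂ : ℤ
  c₁ = quotient d∣b′₁-Ca
  c₂ = quotient d∣b′₂-Ca

  add-back : ∀ S x″ c → x″ - S ≡ c * d → S + d * c ≡ x″
  add-back S x″ c eq = trans (cong (λ w → S + w) (trans (ℤP.*-comm d c) (sym eq))) (cancel S x″)
    where cancel : ∀ S x″ → S + (x″ - S) ≡ x″
          cancel = solve-∀

  Ca+dc≡b′ : OpsZ._⊕v_ (OpsZ.act (mat C₁₁ C₁₂ C₂₁ C₂₂) (vec x y)) (OpsZ.scal d (vec c₁ c₂)) ≡ vec x′ y′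
  Ca+dc≡b′ = vec-cong (add-back _ x′ c₁ (equality d∣b′₁-Ca)) (add-back _ y′ c₂ (equality d∣b′₂-Ca))

  detC : ℤ
  detC = C₁₁ * C₂₂ - C₁₂ * C₂₁

  detC*d≡d′ : detC * d ≡ b₁₁ * b₂₂ - b₁₂ * b₂₁
  detC*d≡d′ = trans (sym (det-multiplicative C₁₁ C₁₂ C₂₁ C₂₂ a₁₁ a₁₂ a₂₁ a₂₂)) (cong OpsZ.det CA≡B)
    where det-multiplicative : ∀ c₁₁ c₁₂ c₂₁ c₂₂ a₁₁ a₁₂ a₂₁ a₂₂ →
            (c₁₁ * a₁₁ + c₁₂ * a₂₁) * (c₂₁ * a₁₂ + c₂₂ * a₂₂) - (c₁₁ * a₁₂ + c₁₂ * a₂₂) * (c₂₁ * a₁₁ + c₂₂ * a₂₁)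
            ≡ (c₁₁ * c₂₂ - c₁₂ * c₂₁) * (a₁₁ * a₂₂ - a₁₂ * a₂₁)
          det-multiplicative = solve-∀

  detC≢0 : detC ≢ 0ℤ
  detC≢0 detC≡0 = d′≢0 (trans (sym detC*d≡d′) (cong (_* d) detC≡0))

  detM≡d²detC : detM ≡ d * d * detC
  detM≡d²detC = trans (cong₂ _-_ (cong₂ _*_ (equality d∣M₁₁) (equality d∣M₂₂)) (cong₂ _*_ (equality d∣M₁₂) (equality d∣M₂₁)))
                      (factor C₁₁ C₁₂ C₂₁ C₂₂ d)
    where factor : ∀ C₁₁ C₁₂ C₂₁ C₂₂ d → C₁₁ * d * (C₂₂ * d) - C₁₂ * d * (C₂₁ * d) ≡ d * d * (C₁₁ * C₂₂ - C₁₂ * C₂₁)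
          factor = solve-∀

  detCₚ : ∀ p → Prime p → ℕ → ℤ
  detCₚ p pp k = L.c₁₁ p pp k * L.c₂₂ p pp k - L.c₁₂ p pp k * L.c₂₁ p pp k

  detC∣1 : detC ∣ 1ℤ
  detC∣1 = prime-powers⇒∣ detC≢0 λ where
    p pp zero _ → ∣-refl
    p pp (suc n) p^n∣detC → ⊥-elim (unit-multiple⇒∤ pp d²≢0
      (detCₚ p pp) (L.u p pp)
      (λ k → subst (λ t → p ^ℤ k ∣ d * d * detCₚ p pp k - t) detM≡d²detC (L.d²detC≡detM p pp k)) (L.detC-unit p pp)
      (subst (_∣ detC) (^ℤ-1 p) (^ℤ-∣-weaken {p} {1} {suc n} (ℕ.s≤s ℕ.z≤n) p^n∣detC)))

  u : ℤ
  u = quotient detC∣1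
  detC*u≡1 : detC * u ≡ 1ℤ
  detC*u≡1 = trans (ℤP.*-comm detC u) (sym (equality detC∣1))

-- Chinese remainder theorem

PrimeExponents : Set
PrimeExponents = (q : ℕ) → Prime q → ℕ

∏-primes< : PrimeExponents → ℕ → ℤ
∏-primes< f zero = 1ℤ
∏-primes< f (suc n) with prime? n
... | yes pn = ∏-primes< f n * n ^ℤ f n pn
... | no _ = ∏-primes< f n

∏-primes<-nonZero : ∀ f n → ℤ.NonZero (∏-primes< f n)
∏-primes<-nonZero f zero = _
∏-primes<-nonZero f (suc n) with prime? n
... | yes pn = ℤP.i*j≢0 (∏-primes< f n) (n ^ℤ f n pn) {{∏-primes<-nonZero f n}} {{^ℤ-nonZero pn (f n pn)}}
... | no _ = ∏-primes<-nonZero f n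

∏-primes<-coprime : ∀ f n {p} → Prime p → n ℕ.≤ p → Coprime (+ p) (∏-primes< f n)
∏-primes<-coprime f zero pp n≤p = coprime-1 _
∏-primes<-coprime f (suc n) pp n<p with prime? n
... | yes pn = coprime-*ʳ (∏-primes<-coprime f n pp (ℕP.<⇒≤ n<p))
                          (coprime-^ℤ-distinct pp pn (λ p≡n → ℕP.<⇒≢ n<p (sym p≡n)) (f n pn))
... | no _ = ∏-primes<-coprime f n pp (ℕP.<⇒≤ n<p)

∏-primes<-split : ∀ f n {p} (pp : Prime p) → p ℕ.< n →
  Σ ℤ λ R → (∏-primes< f n ≡ p ^ℤ f p pp * R) × Coprime (+ p) R
∏-primes<-split f (suc n) {p} pp p<1+n with prime? n | p ℕP.≟ n
... | no ¬pn | yes refl = ⊥-elim (¬pn pp)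
... | no _ | no p≢n = ∏-primes<-split f n pp (ℕP.≤∧≢⇒< (ℕ.s≤s⁻¹ p<1+n) p≢n)
... | yes pn | yes refl = ∏-primes< f n , ℤP.*-comm (∏-primes< f n) (p ^ℤ f p pp) , ∏-primes<-coprime f n pp ℕP.≤-refl
... | yes pn | no p≢n with ∏-primes<-split f n pp (ℕP.≤∧≢⇒< (ℕ.s≤s⁻¹ p<1+n) p≢n)
...   | R , eq , R⊥p = R * n ^ℤ f n pn ,
                       trans (cong (_* n ^ℤ f n pn) eq) (ℤP.*-assoc (p ^ℤ f p pp) R (n ^ℤ f n pn)) ,
                       coprime-*ʳ R⊥p (coprime-^ℤ-distinct pp pn p≢n (f n pn))

module _ (f : PrimeExponents) (α β : (q : ℕ) → Prime q → ℤ) (α⊥q : ∀ q pq → Coprime (+ q) (α q pq)) where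

  SolvesBelow : ℕ → ℤ → Set
  SolvesBelow n X = ∀ q pq → q ℕ.< n → q ^ℤ f q pq ∣ β q pq - α q pq * X

  extend-nonprime : ∀ n → ¬ Prime n → ∀ X → SolvesBelow n X → SolvesBelow (suc n) X
  extend-nonprime n ¬pn X sol q pq q<1+n with q ℕP.≟ n
  ... | yes refl = ⊥-elim (¬pn pq)
  ... | no q≢n = sol q pq (ℕP.≤∧≢⇒< (ℕ.s≤s⁻¹ q<1+n) q≢n)

  -- Correct X by a multiple of M = ∏_{q<n} q^(f q), which does not disturb the congruences below n.
  extend-prime : ∀ n (pn : Prime n) X → SolvesBelow n X →
    ∀ s r → s * n ^ℤ f n pn + r * (α n pn * ∏-primes< f n) ≡ 1ℤ →
    SolvesBelow (suc n) (X + ∏-primes< f n * (r * (β n pn - α n pn * X)))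
  extend-prime n pn X sol s r bézout = sol′
    where
    M t : ℤ
    M = ∏-primes< f n
    t = r * (β n pn - α n pn * X)
    at-n : n ^ℤ f n pn ∣ β n pn - α n pn * (X + M * t)
    at-n = divides ((b - a * X) * s) (begin
      b - a * (X + M * (r * (b - a * X)))       ≡⟨ expand b a X M r ⟩
      (b - a * X) * (1ℤ - r * (a * M))           ≡⟨ cong (λ w → (b - a * X) * (w - r * (a * M))) (sym bézout) ⟩
      (b - a * X) * (s * N + r * (a * M) - r * (a * M)) ≡⟨ cancel (b - a * X) s N (r * (a * M)) ⟩
      (b - a * X) * s * N                        ∎)
      where
      open ≡-Reasoning
      a b N : ℤ
      a = α n pn
      b = β n pn
      N = n ^ℤ f n pn
      expand : ∀ b a X M r → b - a * (X + M * (r * (b - a * X))) ≡ (b - a * X) * (1ℤ - r * (a * M))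
      expand = solve-∀
      cancel : ∀ c s N u → c * (s * N + u - u) ≡ c * s * N
      cancel = solve-∀
    sol′ : SolvesBelow (suc n) (X + M * t)
    sol′ q pq q<1+n with q ℕP.≟ n
    ... | yes refl = at-n
    ... | no q≢n with ∏-primes<-split f n pq (ℕP.≤∧≢⇒< (ℕ.s≤s⁻¹ q<1+n) q≢n)
    ...   | R , M≡ , _ = ∣-subst (∣m∣n⇒∣m-n (sol q pq (ℕP.≤∧≢⇒< (ℕ.s≤s⁻¹ q<1+n) q≢n))
                                            (∣n⇒∣m*n (α q pq * t) (subst (q ^ℤ f q pq ∣_) (sym M≡) (n∣n*m (q ^ℤ f q pq) R))))
                                (regroup (β q pq) (α q pq) X M t)
      where regroup : ∀ β α X M t → (β - α * X) - α * t * M ≡ β - α * (X + M * t)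
            regroup = solve-∀

  chinese-remainder : ∀ n → Σ ℤ (SolvesBelow n)
  chinese-remainder zero = 0ℤ , λ _ _ ()
  chinese-remainder (suc n) with prime? n
  ... | yes pn = _ , extend-prime n pn (proj₁ (chinese-remainder n)) (proj₂ (chinese-remainder n)) s r bézout
    where
    coprime : Coprime (n ^ℤ f n pn) (α n pn * ∏-primes< f n)
    coprime = coprime-^ℤ (f n pn) (coprime-*ʳ (α⊥q n pn) (∏-primes<-coprime f n pn ℕP.≤-refl))
    s r : ℤ
    s = proj₁ coprime
    r = proj₁ (proj₂ coprime)
    bézout : s * n ^ℤ f n pn + r * (α n pn * ∏-primes< f n) ≡ 1ℤ
    bézout = proj₂ (proj₂ coprime)
  ... | no ¬pn = proj₁ (chinese-remainder n) , extend-nonprime n ¬pn (proj₁ (chinese-remainder n)) (proj₂ (chinese-remainder n))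

-- Local Hermite normal forms and unit cofactors

-- The p-adic Hermite normal form of K has diagonal (p^j, p^l), where p^j is the content of the
-- first column and j + l = v is the valuation of det K.
record HermiteData (p f : ℕ) (K₁₁ K₁₂ K₂₁ K₂₂ : ℤ) : Set where
  field
    v j l : ℕ
    v<f : v ℕ.< f
    j+l≡v : j ℕ.+ l ≡ v
    a′ c′ : ℤ
    K₁₁≡ : K₁₁ ≡ p ^ℤ j * a′
    K₂₁≡ : K₂₁ ≡ p ^ℤ j * c′
    a′⊥p⊎c′⊥p : Coprime (+ p) a′ ⊎ Coprime (+ p) c′
    e : ℤ
    detK≡ : K₁₁ * K₂₂ - K₁₂ * K₂₁ ≡ p ^ℤ v * e
    e⊥p : Coprime (+ p) e
    minor≡ : a′ * K₂₂ - c′ * K₁₂ ≡ p ^ℤ l * e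

hermite-data : ∀ {p} → Prime p → ∀ k (K₁₁ K₁₂ K₂₁ K₂₂ w : ℤ) →
  p ^ℤ suc k ∣ (K₁₁ * K₂₂ + - (K₁₂ * K₂₁)) * w - p ^ℤ k → HermiteData p (suc k) K₁₁ K₁₂ K₂₁ K₂₂
hermite-data {p} pp k K₁₁ K₁₂ K₂₁ K₂₂ w detK*w≡p^k = record
  { v = v ; j = j ; l = v ℕ.∸ j ; v<f = v<f ; j+l≡v = j+l≡v ; a′ = a′ ; c′ = c′
  ; K₁₁≡ = a≡ ; K₂₁≡ = c≡ ; a′⊥p⊎c′⊥p = a′⊥p⊎c′⊥p ; e = e ; detK≡ = detK≡ ; e⊥p = e⊥p ; minor≡ = minor≡ }
  where
  detK : ℤ
  detK = K₁₁ * K₂₂ - K₁₂ * K₂₁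

  p^f∤detK : ¬ (p ^ℤ suc k ∣ detK)
  p^f∤detK h = ^ℤ-suc-∤ pp k (mod⇒∣ detK*w≡p^k (∣m⇒∣m*n w h))

  open Valuation (valuation pp (suc k) detK p^f∤detK) renaming (a′ to e ; a≡ to detK≡ ; a′⊥p to e⊥p)
  open CommonValuation (common-valuation pp (suc k) K₁₁ K₂₁ λ (d₁ , d₂) →
    p^f∤detK (∣m∣n⇒∣m-n (∣m⇒∣m*n K₂₂ d₁) (∣n⇒∣m*n K₁₂ d₂)))

  p^j∣detK : p ^ℤ j ∣ detK
  p^j∣detK = ∣m∣n⇒∣m-n (∣m⇒∣m*n K₂₂ (subst (p ^ℤ j ∣_) (sym a≡) (n∣n*m (p ^ℤ j) a′)))
                        (∣n⇒∣m*n K₁₂ (subst (p ^ℤ j ∣_) (sym c≡) (n∣n*m (p ^ℤ j) c′)))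

  j+l≡v : j ℕ.+ (v ℕ.∸ j) ≡ v
  j+l≡v = ℕP.m+[n∸m]≡n {j} {v} (^ℤ-∣-unit-multiple⇒≤ pp p^j∣detK detK≡ e⊥p)

  minor≡ : a′ * K₂₂ - c′ * K₁₂ ≡ p ^ℤ (v ℕ.∸ j) * e
  minor≡ = ℤP.*-cancelˡ-≡ (p ^ℤ j) _ _ {{^ℤ-nonZero pp j}} (begin
    p ^ℤ j * (a′ * K₂₂ - c′ * K₁₂)          ≡⟨ distribute (p ^ℤ j) a′ c′ K₂₂ K₁₂ ⟩
    p ^ℤ j * a′ * K₂₂ - K₁₂ * (p ^ℤ j * c′) ≡⟨ cong₂ (λ s t → s * K₂₂ - K₁₂ * t) (sym a≡) (sym c≡) ⟩
    detK                                      ≡⟨ detK≡ ⟩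
    p ^ℤ v * e                                ≡⟨ cong (λ t → p ^ℤ t * e) (sym j+l≡v) ⟩
    p ^ℤ (j ℕ.+ (v ℕ.∸ j)) * e                ≡⟨ cong (_* e) (^ℤ-+ p j (v ℕ.∸ j)) ⟩
    p ^ℤ j * p ^ℤ (v ℕ.∸ j) * e              ≡⟨ ℤP.*-assoc (p ^ℤ j) (p ^ℤ (v ℕ.∸ j)) e ⟩
    p ^ℤ j * (p ^ℤ (v ℕ.∸ j) * e)            ∎)
    where
    open ≡-Reasoning
    distribute : ∀ P a c d b → P * (a * d - c * b) ≡ P * a * d - b * (P * c)
    distribute = solve-∀

adjugate : M2 ℤ → M2 ℤ
adjugate (mat a b c d) = mat d (- b) (- c) a

-- (c₁, c₂) = (a₁, a₂) adj(B) i / V, so (c₁, c₂) B = (a₁, a₂) det(B) i / V = e i (a₁, a₂).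
row-times-matrix : ∀ (V e i b₁₁ b₁₂ b₂₁ b₂₂ a₁ a₂ c₁ c₂ : ℤ) → .{{ℤ.NonZero V}} →
  b₁₁ * b₂₂ - b₁₂ * b₂₁ ≡ V * e →
  V * c₁ ≡ (a₁ * b₂₂ + a₂ * - b₂₁) * i → V * c₂ ≡ (a₁ * - b₁₂ + a₂ * b₁₁) * i →
  (c₁ * b₁₁ + c₂ * b₂₁ ≡ a₁ * e * i) × (c₁ * b₁₂ + c₂ * b₂₂ ≡ a₂ * e * i)
row-times-matrix V e i b₁₁ b₁₂ b₂₁ b₂₂ a₁ a₂ c₁ c₂ detB≡ Vc₁≡ Vc₂≡ =
  ℤP.*-cancelˡ-≡ V _ _ (begin
    V * (c₁ * b₁₁ + c₂ * b₂₁)                 ≡⟨ distribute V c₁ c₂ b₁₁ b₂₁ ⟩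
    V * c₁ * b₁₁ + V * c₂ * b₂₁               ≡⟨ cong₂ (λ s t → s * b₁₁ + t * b₂₁) Vc₁≡ Vc₂≡ ⟩
    _                                          ≡⟨ first-column a₁ a₂ b₁₁ b₁₂ b₂₁ b₂₂ i ⟩
    a₁ * i * (b₁₁ * b₂₂ - b₁₂ * b₂₁)          ≡⟨ cong (a₁ * i *_) detB≡ ⟩
    a₁ * i * (V * e)                           ≡⟨ rotate a₁ i V e ⟩
    V * (a₁ * e * i)                           ∎) ,
  ℤP.*-cancelˡ-≡ V _ _ (begin
    V * (c₁ * b₁₂ + c₂ * b₂₂)                 ≡⟨ distribute V c₁ c₂ b₁₂ b₂₂ ⟩
    V * c₁ * b₁₂ + V * c₂ * b₂₂               ≡⟨ cong₂ (λ s t → s * b₁₂ + t * b₂₂) Vc₁≡ Vc₂≡ ⟩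
    _                                          ≡⟨ second-column a₁ a₂ b₁₁ b₁₂ b₂₁ b₂₂ i ⟩
    a₂ * i * (b₁₁ * b₂₂ - b₁₂ * b₂₁)          ≡⟨ cong (a₂ * i *_) detB≡ ⟩
    a₂ * i * (V * e)                           ≡⟨ rotate a₂ i V e ⟩
    V * (a₂ * e * i)                           ∎)
  where
  open ≡-Reasoning
  distribute : ∀ V c₁ c₂ b b′ → V * (c₁ * b + c₂ * b′) ≡ V * c₁ * b + V * c₂ * b′
  distribute = solve-∀
  first-column : ∀ a₁ a₂ b₁₁ b₁₂ b₂₁ b₂₂ i →
    (a₁ * b₂₂ + a₂ * - b₂₁) * i * b₁₁ + (a₁ * - b₁₂ + a₂ * b₁₁) * i * b₂₁ ≡ a₁ * i * (b₁₁ * b₂₂ - b₁₂ * b₂₁)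
  first-column = solve-∀
  second-column : ∀ a₁ a₂ b₁₁ b₁₂ b₂₁ b₂₂ i →
    (a₁ * b₂₂ + a₂ * - b₂₁) * i * b₁₂ + (a₁ * - b₁₂ + a₂ * b₁₁) * i * b₂₂ ≡ a₂ * i * (b₁₁ * b₂₂ - b₁₂ * b₂₁)
  second-column = solve-∀
  rotate : ∀ a i V e → a * i * (V * e) ≡ V * (a * e * i)
  rotate = solve-∀

det-of-scaled-product : ∀ (c₁₁ c₁₂ c₂₁ c₂₂ b₁₁ b₁₂ b₂₁ b₂₂ a₁₁ a₁₂ a₂₁ a₂₂ e i : ℤ) →
  (c₁₁ * b₁₁ + c₁₂ * b₂₁ ≡ a₁₁ * e * i) × (c₁₁ * b₁₂ + c₁₂ * b₂₂ ≡ a₁₂ * e * i) →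
  (c₂₁ * b₁₁ + c₂₂ * b₂₁ ≡ a₂₁ * e * i) × (c₂₁ * b₁₂ + c₂₂ * b₂₂ ≡ a₂₂ * e * i) →
  (c₁₁ * c₂₂ - c₁₂ * c₂₁) * (b₁₁ * b₂₂ - b₁₂ * b₂₁) ≡ (a₁₁ * a₂₂ - a₁₂ * a₂₁) * e * e * i * i
det-of-scaled-product c₁₁ c₁₂ c₂₁ c₂₂ b₁₁ b₁₂ b₂₁ b₂₂ a₁₁ a₁₂ a₂₁ a₂₂ e i (r₁₁ , r₁₂) (r₂₁ , r₂₂) =
  trans (det-multiplicative c₁₁ c₁₂ c₂₁ c₂₂ b₁₁ b₁₂ b₂₁ b₂₂)
        (trans (cong₂ _-_ (cong₂ _*_ r₁₁ r₂₂) (cong₂ _*_ r₁₂ r₂₁)) (scale a₁₁ a₁₂ a₂₁ a₂₂ e i))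
  where
  det-multiplicative : ∀ c₁₁ c₁₂ c₂₁ c₂₂ b₁₁ b₁₂ b₂₁ b₂₂ →
    (c₁₁ * c₂₂ - c₁₂ * c₂₁) * (b₁₁ * b₂₂ - b₁₂ * b₂₁)
    ≡ (c₁₁ * b₁₁ + c₁₂ * b₂₁) * (c₂₁ * b₁₂ + c₂₂ * b₂₂) - (c₁₁ * b₁₂ + c₁₂ * b₂₂) * (c₂₁ * b₁₁ + c₂₂ * b₂₁)
  det-multiplicative = solve-∀
  scale : ∀ a₁₁ a₁₂ a₂₁ a₂₂ e i →
    a₁₁ * e * i * (a₂₂ * e * i) - a₁₂ * e * i * (a₂₁ * e * i) ≡ (a₁₁ * a₂₂ - a₁₂ * a₂₁) * e * e * i * i
  scale = solve-∀

-- det C · p^v e = det A · e² i², and det A = p^v · (unit) modulo p^(v+1).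
det-cofactor-coprime : ∀ {p} → Prime p → ∀ v (detC e i eA detA : ℤ) →
  Coprime (+ p) e → Coprime (+ p) i → Coprime (+ p) eA →
  detC * (p ^ℤ v * e) ≡ detA * e * e * i * i → p ^ℤ suc v ∣ detA - p ^ℤ v * eA → Coprime (+ p) detC
det-cofactor-coprime {p} pp v detC e i eA detA e⊥p i⊥p eA⊥p eq (divides t detA≡) =
  coprime-*⇒coprime {z = e} (subst (Coprime (+ p)) (sym detC*e≡)
    (coprime-*ʳ (coprime-*ʳ (coprime-*ʳ (coprime-*ʳ eA′⊥p e⊥p) e⊥p) i⊥p) i⊥p))
  where
  V eA′ : ℤ
  V = p ^ℤ v
  eA′ = eA + t * + p
  eA′⊥p : Coprime (+ p) eA′
  eA′⊥p = coprime-resp-mod eA⊥p (divides t (cancel eA (t * + p)))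
    where cancel : ∀ a b → a + b - a ≡ b
          cancel = solve-∀
  detA≡Ve : detA ≡ V * eA′
  detA≡Ve = trans (split detA (V * eA)) (trans (cong (_+ V * eA) detA≡)
              (trans (cong (λ w → t * w + V * eA) (^ℤ-suc p v)) (collect t (+ p) V eA)))
    where split : ∀ a b → a ≡ (a - b) + b
          split = solve-∀
          collect : ∀ t p V eA → t * (p * V) + V * eA ≡ V * (eA + t * p)
          collect = solve-∀
  detC*e≡ : detC * e ≡ eA′ * e * e * i * i
  detC*e≡ = ℤP.*-cancelˡ-≡ V _ _ {{^ℤ-nonZero pp v}}
    (trans (swap V detC e) (trans eq (trans (cong (λ w → w * e * e * i * i) detA≡Ve) (reassoc V eA′ e i))))
    where swap : ∀ V d e → V * (d * e) ≡ d * (V * e)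
          swap = solve-∀
          reassoc : ∀ V w e i → V * w * e * e * i * i ≡ V * (w * e * e * i * i)
          reassoc = solve-∀

EntriesDivisibleAt : ∀ {p} → ℕ → M2 ℤ[ p ] → Set
EntriesDivisibleAt {p} v (mat z₁₁ z₁₂ z₂₁ z₂₂) =
  (p ^ℤ v ∣ seq z₁₁ v) × (p ^ℤ v ∣ seq z₁₂ v) × (p ^ℤ v ∣ seq z₂₁ v) × (p ^ℤ v ∣ seq z₂₂ v)

-- Sufficient conditions for A B⁻¹ ∈ GL₂(ℤ_p).
record CofactorData {p : ℕ} (A : M2 ℤ[ p ]) (B : M2 ℤ) : Set where
  field
    v : ℕ
    e : ℤ
    e⊥p : Coprime (+ p) e
    detB≡ : OpsZ.det B ≡ p ^ℤ v * e
    p^v∣A·adjB : EntriesDivisibleAt v (OpsP._·_ p A (ιM (adjugate B)))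
    eA : ℤ
    eA⊥p : Coprime (+ p) eA
    detA≡ : p ^ℤ suc v ∣ seq (OpsP.det p A) (suc v) - p ^ℤ v * eA

module UnitCofactor {p : ℕ} (pp : Prime p) (A₁₁ A₁₂ A₂₁ A₂₂ a₁ a₂ : ℤ[ p ]) (b₁₁ b₁₂ b₂₁ b₂₂ : ℤ)
                    (D : CofactorData (mat A₁₁ A₁₂ A₂₁ A₂₂) (mat b₁₁ b₁₂ b₂₁ b₂₂)) where

  open CofactorData D

  B : M2 ℤ
  B = mat b₁₁ b₁₂ b₂₁ b₂₂

  opaque
    e⁻¹ : ℤ[ p ]
    e⁻¹ = proj₁ (coprime⇒unit (ι e) e⊥p)
    e*e⁻¹≡1 : ∀ n → p ^ℤ n ∣ e * seq e⁻¹ n - 1ℤ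
    e*e⁻¹≡1 = proj₂ (coprime⇒unit (ι e) e⊥p)

  divisible-from-v : ∀ (z : ℤ[ p ]) → p ^ℤ v ∣ seq z v → ∀ n → p ^ℤ v ∣ seq z (n ℕ.+ v)
  divisible-from-v z h n = seq-∣-stable z ℕP.≤-refl (ℕP.m≤n+m v n) h

  opaque
    -- z / det B, computed as (z / p^v) e⁻¹.
    divide-by-detB : (z : ℤ[ p ]) → p ^ℤ v ∣ seq z v → ℤ[ p ]
    divide-by-detB z h = proj₁ (^-quotient pp v z (divisible-from-v z h)) *p e⁻¹

    divide-by-detB-spec : ∀ z h n → p ^ℤ v * seq (divide-by-detB z h) n ≡ seq z (n ℕ.+ v) * seq e⁻¹ n
    divide-by-detB-spec z h n =
      trans (sym (ℤP.*-assoc (p ^ℤ v) (seq q n) (seq e⁻¹ n))) (cong (_* seq e⁻¹ n) (proj₂ quotient-by-p^v n))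
      where
      quotient-by-p^v : Σ ℤ[ p ] λ q → ∀ n → p ^ℤ v * seq q n ≡ seq z (n ℕ.+ v)
      quotient-by-p^v = ^-quotient pp v z (divisible-from-v z h)
      q : ℤ[ p ]
      q = proj₁ quotient-by-p^v

  shifted-e*e⁻¹≡ : ∀ (x : ℤ[ p ]) n c → c ≡ seq x (n ℕ.+ v) * e * seq e⁻¹ n → p ^ℤ n ∣ c - seq x n
  shifted-e*e⁻¹≡ x n c refl = ∣-subst (∣m∣n⇒∣m+n (∣n⇒∣m*n (seq x (n ℕ.+ v)) (e*e⁻¹≡1 n)) (seq-mono-mod x (ℕP.m≤m+n n v)))
                                  (regroup (seq x (n ℕ.+ v)) e (seq e⁻¹ n) (seq x n))
    where regroup : ∀ x′ e i x → x′ * (e * i - 1ℤ) + (x′ - x) ≡ x′ * e * i - x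
          regroup = solve-∀

  Z : M2 ℤ[ p ]
  Z = OpsP._·_ p (mat A₁₁ A₁₂ A₂₁ A₂₂) (ιM (adjugate B))

  C : M2 ℤ[ p ]
  C = mat (divide-by-detB (M2.m11 Z) (proj₁ p^v∣A·adjB)) (divide-by-detB (M2.m12 Z) (proj₁ (proj₂ p^v∣A·adjB)))
          (divide-by-detB (M2.m21 Z) (proj₁ (proj₂ (proj₂ p^v∣A·adjB))))
          (divide-by-detB (M2.m22 Z) (proj₂ (proj₂ (proj₂ p^v∣A·adjB))))

  open M2 C renaming (m11 to C₁₁ ; m12 to C₁₂ ; m21 to C₂₁ ; m22 to C₂₂)

  row₁ : ∀ n → (seq C₁₁ n * b₁₁ + seq C₁₂ n * b₂₁ ≡ seq A₁₁ (n ℕ.+ v) * e * seq e⁻¹ n)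
             × (seq C₁₁ n * b₁₂ + seq C₁₂ n * b₂₂ ≡ seq A₁₂ (n ℕ.+ v) * e * seq e⁻¹ n)
  row₁ n = row-times-matrix (p ^ℤ v) e (seq e⁻¹ n) b₁₁ b₁₂ b₂₁ b₂₂ (seq A₁₁ (n ℕ.+ v)) (seq A₁₂ (n ℕ.+ v))
             (seq C₁₁ n) (seq C₁₂ n) {{^ℤ-nonZero pp v}} detB≡
             (divide-by-detB-spec (M2.m11 Z) _ n) (divide-by-detB-spec (M2.m12 Z) _ n)
  row₂ : ∀ n → (seq C₂₁ n * b₁₁ + seq C₂₂ n * b₂₁ ≡ seq A₂₁ (n ℕ.+ v) * e * seq e⁻¹ n)
             × (seq C₂₁ n * b₁₂ + seq C₂₂ n * b₂₂ ≡ seq A₂₂ (n ℕ.+ v) * e * seq e⁻¹ n)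
  row₂ n = row-times-matrix (p ^ℤ v) e (seq e⁻¹ n) b₁₁ b₁₂ b₂₁ b₂₂ (seq A₂₁ (n ℕ.+ v)) (seq A₂₂ (n ℕ.+ v))
             (seq C₂₁ n) (seq C₂₂ n) {{^ℤ-nonZero pp v}} detB≡
             (divide-by-detB-spec (M2.m21 Z) _ n) (divide-by-detB-spec (M2.m22 Z) _ n)

  C·B≈A : EqsP._≈M_ p (OpsP._·_ p C (ιM B)) (mat A₁₁ A₁₂ A₂₁ A₂₂)
  C·B≈A = (λ n → shifted-e*e⁻¹≡ A₁₁ n _ (proj₁ (row₁ n))) , (λ n → shifted-e*e⁻¹≡ A₁₂ n _ (proj₂ (row₁ n))) ,
          (λ n → shifted-e*e⁻¹≡ A₂₁ n _ (proj₁ (row₂ n))) , (λ n → shifted-e*e⁻¹≡ A₂₂ n _ (proj₂ (row₂ n)))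

  e⁻¹⊥p : Coprime (+ p) (seq e⁻¹ 1)
  e⁻¹⊥p = coprime-*⇒coprime {z = e} (subst (Coprime (+ p)) (ℤP.*-comm e (seq e⁻¹ 1))
            (≡1-mod⇒coprime (subst (_∣ e * seq e⁻¹ 1 - 1ℤ) (^ℤ-1 p) (e*e⁻¹≡1 1))))

  opaque
    C-unit : UnitZp p (OpsP.det p C)
    C-unit = coprime⇒unit (OpsP.det p C) (det-cofactor-coprime pp v (seq (OpsP.det p C) 1) e (seq e⁻¹ 1) eA
      (seq (OpsP.det p (mat A₁₁ A₁₂ A₂₁ A₂₂)) (suc v)) e⊥p e⁻¹⊥p eA⊥p
      (trans (cong (seq (OpsP.det p C) 1 *_) (sym detB≡))
             (det-of-scaled-product (seq C₁₁ 1) (seq C₁₂ 1) (seq C₂₁ 1) (seq C₂₂ 1) b₁₁ b₁₂ b₂₁ b₂₂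
                (seq A₁₁ (suc v)) (seq A₁₂ (suc v)) (seq A₂₁ (suc v)) (seq A₂₂ (suc v)) e (seq e⁻¹ 1) (row₁ 1) (row₂ 1)))
      detA≡)

  u : ℤ[ p ]
  u = proj₁ C-unit

  -- the vector part b must approximate C⁻¹ a = adj(C) a u modulo p^v
  target₁ target₂ : ℤ
  target₁ = (seq C₂₂ v * seq a₁ v - seq C₁₂ v * seq a₂ v) * seq u v
  target₂ = (seq C₁₁ v * seq a₂ v - seq C₂₁ v * seq a₁ v) * seq u v

  module _ (b₁ b₂ : ℤ) (b₁≡ : p ^ℤ v ∣ target₁ - b₁) (b₂≡ : p ^ℤ v ∣ target₂ - b₂) where

    residual : (Cx Cy x : ℤ[ p ]) → ℤ[ p ]
    residual Cx Cy x = x +p (-p ((Cx *p ι b₁) +p (Cy *p ι b₂)))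

    -- the residual a - C b of each row is divisible by p^v: expand it as
    -- -(det C u - 1) a + C (adj(C) a u - b)
    p^v∣residual₁ : p ^ℤ v ∣ seq (residual C₁₁ C₁₂ a₁) v
    p^v∣residual₁ = ∣-subst (∣m∣n⇒∣m+n (∣m∣n⇒∣m+n (∣m⇒∣-m (∣m⇒∣m*n (seq a₁ v) (proj₂ C-unit v))) (∣n⇒∣m*n (seq C₁₁ v) b₁≡))
                                       (∣n⇒∣m*n (seq C₁₂ v) b₂≡))
                            (sym (expand (seq C₁₁ v) (seq C₁₂ v) (seq C₂₁ v) (seq C₂₂ v) (seq a₁ v) (seq a₂ v) (seq u v) b₁ b₂))
      where expand : ∀ c₁₁ c₁₂ c₂₁ c₂₂ a₁ a₂ u b₁ b₂ →
              a₁ + - (c₁₁ * b₁ + c₁₂ * b₂) ≡ - (((c₁₁ * c₂₂ + - (c₁₂ * c₂₁)) * u - 1ℤ) * a₁)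
                + c₁₁ * ((c₂₂ * a₁ - c₁₂ * a₂) * u - b₁) + c₁₂ * ((c₁₁ * a₂ - c₂₁ * a₁) * u - b₂)
            expand = solve-∀
    p^v∣residual₂ : p ^ℤ v ∣ seq (residual C₂₁ C₂₂ a₂) v
    p^v∣residual₂ = ∣-subst (∣m∣n⇒∣m+n (∣m∣n⇒∣m+n (∣m⇒∣-m (∣m⇒∣m*n (seq a₂ v) (proj₂ C-unit v))) (∣n⇒∣m*n (seq C₂₂ v) b₂≡))
                                       (∣n⇒∣m*n (seq C₂₁ v) b₁≡))
                            (sym (expand (seq C₁₁ v) (seq C₁₂ v) (seq C₂₁ v) (seq C₂₂ v) (seq a₁ v) (seq a₂ v) (seq u v) b₁ b₂))
      where expand : ∀ c₁₁ c₁₂ c₂₁ c₂₂ a₁ a₂ u b₁ b₂ →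
              a₂ + - (c₂₁ * b₁ + c₂₂ * b₂) ≡ - (((c₁₁ * c₂₂ + - (c₁₂ * c₂₁)) * u - 1ℤ) * a₂)
                + c₂₂ * ((c₁₁ * a₂ - c₂₁ * a₁) * u - b₂) + c₂₁ * ((c₂₂ * a₁ - c₁₂ * a₂) * u - b₁)
            expand = solve-∀

    c : V2 ℤ[ p ]
    c = vec (divide-by-detB (residual C₁₁ C₁₂ a₁) p^v∣residual₁) (divide-by-detB (residual C₂₁ C₂₂ a₂) p^v∣residual₂)

    row-vector : ∀ (Cx Cy x : ℤ[ p ]) (h : p ^ℤ v ∣ seq (residual Cx Cy x) v) n →
      p ^ℤ n ∣ ((seq Cx n * b₁ + seq Cy n * b₂) + (b₁₁ * b₂₂ - b₁₂ * b₂₁) * seq (divide-by-detB (residual Cx Cy x) h) n) - seq x n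
    row-vector Cx Cy x h n = ∣-subst
      (∣m∣n⇒∣m+n (∣m∣n⇒∣m+n (∣m⇒∣m*n (x′ - S′) (e*e⁻¹≡1 n)) S≡S′) (seq-mono-mod x (ℕP.m≤m+n n v)))
      (sym (begin
        S + (b₁₁ * b₂₂ - b₁₂ * b₂₁) * q - seq x n    ≡⟨ cong (λ w → S + w * q - seq x n) detB≡ ⟩
        S + p ^ℤ v * e * q - seq x n                  ≡⟨ cong (λ w → S + w - seq x n) (swap (p ^ℤ v) e q) ⟩
        S + e * (p ^ℤ v * q) - seq x n                ≡⟨ cong (λ w → S + e * w - seq x n) (divide-by-detB-spec (residual Cx Cy x) h n) ⟩
        S + e * ((x′ + - S′) * seq e⁻¹ n) - seq x n   ≡⟨ regroup S S′ (seq x n) x′ (seq e⁻¹ n) e ⟩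
        (e * seq e⁻¹ n - 1ℤ) * (x′ - S′) + (S - S′) + (x′ - seq x n) ∎))
      where
      open ≡-Reasoning
      S S′ x′ q : ℤ
      S = seq Cx n * b₁ + seq Cy n * b₂
      S′ = seq Cx (n ℕ.+ v) * b₁ + seq Cy (n ℕ.+ v) * b₂
      x′ = seq x (n ℕ.+ v)
      q = seq (divide-by-detB (residual Cx Cy x) h) n
      S≡S′ : p ^ℤ n ∣ S - S′
      S≡S′ = ∣-subst (∣m∣n⇒∣m+n (∣m⇒∣m*n b₁ (mod-sym (seq Cx (n ℕ.+ v)) (seq Cx n) (seq-mono-mod Cx (ℕP.m≤m+n n v))))
                                (∣m⇒∣m*n b₂ (mod-sym (seq Cy (n ℕ.+ v)) (seq Cy n) (seq-mono-mod Cy (ℕP.m≤m+n n v)))))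
                     (collect (seq Cx n) (seq Cx (n ℕ.+ v)) (seq Cy n) (seq Cy (n ℕ.+ v)) b₁ b₂)
        where collect : ∀ c c′ d d′ b₁ b₂ → (c - c′) * b₁ + (d - d′) * b₂ ≡ (c * b₁ + d * b₂) - (c′ * b₁ + d′ * b₂)
              collect = solve-∀
      swap : ∀ V e q → V * e * q ≡ e * (V * q)
      swap = solve-∀
      regroup : ∀ S S′ x x′ i e → S + e * ((x′ + - S′) * i) - x ≡ (e * i - 1ℤ) * (x′ - S′) + (S - S′) + (x′ - x)
      regroup = solve-∀

    Cb+detB·c≈a : EqsP._≈V_ p (OpsP._⊕v_ p (OpsP.act p C (ιV (vec b₁ b₂))) (OpsP.scal p (OpsP.det p (ιM B)) c)) (vec a₁ a₂)
    Cb+detB·c≈a = row-vector C₁₁ C₁₂ a₁ p^v∣residual₁ , row-vector C₂₁ C₂₂ a₂ p^v∣residual₂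

upper : ℤ → ℤ → ℤ → M2 ℤ
upper P X Q = mat P X 0ℤ Q

module _ {p : ℕ} (pp : Prime p) (A₁₁ A₁₂ A₂₁ A₂₂ : ℤ[ p ]) (P X Q : ℤ) where

  private
    A : M2 ℤ[ p ]
    A = mat A₁₁ A₁₂ A₂₁ A₂₂

  cofactor-data-unimodular : Coprime (+ p) P → Coprime (+ p) Q → UnitZp p (OpsP.det p A) →
    CofactorData A (upper P X Q)
  cofactor-data-unimodular P⊥p Q⊥p (w , detA*w≡1) = record
    { v = 0 ; e = P * Q ; e⊥p = coprime-*ʳ P⊥p Q⊥p ; detB≡ = scale P X Q
    ; p^v∣A·adjB = 1∣n _ , 1∣n _ , 1∣n _ , 1∣n _
    ; eA = detA₁ ; eA⊥p = coprime-*⇒coprime {z = seq w 1} (≡1-mod⇒coprime (subst (_∣ detA₁ * seq w 1 - 1ℤ) (^ℤ-1 p) (detA*w≡1 1)))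
    ; detA≡ = ∣-subst (n∣0 (p ^ℤ 1)) (cancel detA₁) }
    where
    detA₁ : ℤ
    detA₁ = seq (OpsP.det p A) 1
    scale : ∀ P X Q → P * Q - X * 0ℤ ≡ 1ℤ * (P * Q)
    scale = solve-∀
    cancel : ∀ d → 0ℤ ≡ d - 1ℤ * d
    cancel = solve-∀

  module _ (k : ℕ) (H : HermiteData p (suc k) (seq A₁₁ (suc k)) (seq A₁₂ (suc k)) (seq A₂₁ (suc k)) (seq A₂₂ (suc k)))
           (P′ Q′ : ℤ) (P≡ : P ≡ p ^ℤ HermiteData.j H * P′) (P′⊥p : Coprime (+ p) P′)
           (Q≡ : Q ≡ p ^ℤ HermiteData.l H * Q′) (Q′⊥p : Coprime (+ p) Q′)
           (X≡₁ : p ^ℤ HermiteData.l H ∣ seq A₁₂ (suc k) * P′ - HermiteData.a′ H * X)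
           (X≡₂ : p ^ℤ HermiteData.l H ∣ seq A₂₂ (suc k) * P′ - HermiteData.c′ H * X) where

    open HermiteData H

    private
      m : ℕ
      m = suc k
      K₁₁ K₁₂ K₂₁ K₂₂ : ℤ
      K₁₁ = seq A₁₁ m
      K₁₂ = seq A₁₂ m
      K₂₁ = seq A₂₁ m
      K₂₂ = seq A₂₂ m
      v≤m : v ℕ.≤ m
      v≤m = ℕP.<⇒≤ v<f

      p^v∣ : ∀ {z} → p ^ℤ (j ℕ.+ l) ∣ z → p ^ℤ v ∣ z
      p^v∣ {z} = subst (λ t → p ^ℤ t ∣ z) j+l≡v

      p^j·p^l∣ : ∀ {z} → p ^ℤ l ∣ z → p ^ℤ (j ℕ.+ l) ∣ p ^ℤ j * z
      p^j·p^l∣ {z} h = subst (_∣ p ^ℤ j * z) (sym (^ℤ-+ p j l)) (*-monoʳ-∣ (p ^ℤ j) h)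

      first-column : ∀ {K₁ c′} K₂ → K₁ ≡ p ^ℤ j * c′ → p ^ℤ v ∣ K₁ * Q + K₂ * - 0ℤ
      first-column {K₁} {c′} K₂ refl = p^v∣ (∣-subst (p^j·p^l∣ (n∣n*m (p ^ℤ l) (c′ * Q′)))
        (sym (trans (cong (λ t → p ^ℤ j * c′ * t + K₂ * - 0ℤ) Q≡) (regroup (p ^ℤ j) c′ (p ^ℤ l) Q′ K₂))))
        where regroup : ∀ J a L q k → J * a * (L * q) + k * - 0ℤ ≡ J * (L * (a * q))
              regroup = solve-∀

      second-column : ∀ {K₁ c′} K₂ → K₁ ≡ p ^ℤ j * c′ → p ^ℤ l ∣ K₂ * P′ - c′ * X → p ^ℤ v ∣ K₁ * - X + K₂ * P
      second-column {K₁} {c′} K₂ refl h = p^v∣ (∣-subst (p^j·p^l∣ h)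
        (sym (trans (cong (λ t → p ^ℤ j * c′ * - X + K₂ * t) P≡) (regroup (p ^ℤ j) c′ X K₂ P′))))
        where regroup : ∀ J a X k P′ → J * a * - X + k * (J * P′) ≡ J * (k * P′ - a * X)
              regroup = solve-∀

    cofactor-data-hermite : CofactorData A (upper P X Q)
    cofactor-data-hermite = record
      { v = v ; e = P′ * Q′ ; e⊥p = coprime-*ʳ P′⊥p Q′⊥p ; detB≡ = detB≡
      ; p^v∣A·adjB = at-v (M2.m11 Z) (first-column K₁₂ K₁₁≡) , at-v (M2.m12 Z) (second-column K₁₂ K₁₁≡ X≡₁) ,
                     at-v (M2.m21 Z) (first-column K₂₂ K₂₁≡) , at-v (M2.m22 Z) (second-column K₂₂ K₂₁≡ X≡₂)
      ; eA = e ; eA⊥p = e⊥p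
      ; detA≡ = subst (λ t → p ^ℤ suc v ∣ seq (OpsP.det p A) (suc v) - t) detK≡
                      (mod-sym (seq (OpsP.det p A) m) (seq (OpsP.det p A) (suc v)) (seq-mono-mod (OpsP.det p A) v<f)) }
      where
      Z : M2 ℤ[ p ]
      Z = OpsP._·_ p A (ιM (adjugate (upper P X Q)))
      at-v : ∀ (z : ℤ[ p ]) → p ^ℤ v ∣ seq z m → p ^ℤ v ∣ seq z v
      at-v z = seq-∣-stable z v≤m ℕP.≤-refl
      detB≡ : P * Q - X * 0ℤ ≡ p ^ℤ v * (P′ * Q′)
      detB≡ = trans (cong₂ (λ s t → s * t - X * 0ℤ) P≡ Q≡)
                    (trans (regroup (p ^ℤ j) P′ (p ^ℤ l) Q′ X)
                    (trans (cong (_* (P′ * Q′)) (sym (^ℤ-+ p j l))) (cong (λ t → p ^ℤ t * (P′ * Q′)) j+l≡v)))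
        where regroup : ∀ J P L Q X → J * P * (L * Q) - X * 0ℤ ≡ J * L * (P * Q)
              regroup = solve-∀

pick : ∀ {p} {a′ c′ : ℤ} → Coprime (+ p) a′ ⊎ Coprime (+ p) c′ → ℤ → ℤ → ℤ
pick (inj₁ _) x y = x
pick (inj₂ _) x y = y

pick-coprime : ∀ {p} {a′ c′ : ℤ} (u : Coprime (+ p) a′ ⊎ Coprime (+ p) c′) → Coprime (+ p) (pick u a′ c′)
pick-coprime (inj₁ a′⊥p) = a′⊥p
pick-coprime (inj₂ c′⊥p) = c′⊥p

-- Since a′ K₂₂ - c′ K₁₂ ≡ 0 modulo p^l, the congruence for the unit among a′, c′ implies the other one.
picked-congruence⇒both : ∀ {p} {a′ c′} (u : Coprime (+ p) a′ ⊎ Coprime (+ p) c′) l (K₁₂ K₂₂ P′ X : ℤ) →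
  p ^ℤ l ∣ a′ * K₂₂ - c′ * K₁₂ → p ^ℤ l ∣ pick u (K₁₂ * P′) (K₂₂ * P′) - pick u a′ c′ * X →
  (p ^ℤ l ∣ K₁₂ * P′ - a′ * X) × (p ^ℤ l ∣ K₂₂ * P′ - c′ * X)
picked-congruence⇒both {a′ = a′} {c′} (inj₁ a′⊥p) l K₁₂ K₂₂ P′ X minor h =
  h , coprime-divisor (coprime-^ℤ l a′⊥p) (∣-subst (∣m∣n⇒∣m+n (∣n⇒∣m*n P′ minor) (∣n⇒∣m*n c′ h)) (combine a′ c′ K₁₂ K₂₂ P′ X))
  where combine : ∀ a c K₁₂ K₂₂ P X → P * (a * K₂₂ - c * K₁₂) + c * (K₁₂ * P - a * X) ≡ a * (K₂₂ * P - c * X)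
        combine = solve-∀
picked-congruence⇒both {a′ = a′} {c′} (inj₂ c′⊥p) l K₁₂ K₂₂ P′ X minor h =
  coprime-divisor (coprime-^ℤ l c′⊥p) (∣-subst (∣m∣n⇒∣m+n (∣m⇒∣-m (∣n⇒∣m*n P′ minor)) (∣n⇒∣m*n a′ h)) (combine a′ c′ K₁₂ K₂₂ P′ X)) , h
  where combine : ∀ a c K₁₂ K₂₂ P X → - (P * (a * K₂₂ - c * K₁₂)) + a * (K₂₂ * P - c * X) ≡ c * (K₁₂ * P - a * X)
        combine = solve-∀

-- Surjectivity

module Surjectivity (α : (p : ℕ) → Prime p → Δp p) (N : ℕ)
                    (unit-beyond-N : (p : ℕ) (pp : Prime p) → N ℕ.< p → UnitZp p (OpsP.det p (proj₁ (proj₁ (α p pp))))) where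

  A : (p : ℕ) → Prime p → M2 ℤ[ p ]
  A p pp = proj₁ (proj₁ (α p pp))
  A₁₁ A₁₂ A₂₁ A₂₂ a₁ a₂ : (p : ℕ) → Prime p → ℤ[ p ]
  A₁₁ p pp = M2.m11 (A p pp)
  A₁₂ p pp = M2.m12 (A p pp)
  A₂₁ p pp = M2.m21 (A p pp)
  A₂₂ p pp = M2.m22 (A p pp)
  a₁ p pp = V2.v1 (proj₂ (proj₁ (α p pp)))
  a₂ p pp = V2.v2 (proj₂ (proj₁ (α p pp)))

  -- det A_p divides p^k in ℤ_p, so det A_p has valuation below k + 1
  k : PrimeExponents
  k p pp = proj₁ (proj₂ (α p pp))

  K : (p : ℕ) → Prime p → (M2 ℤ[ p ] → ℤ[ p ]) → ℤ
  K p pp entry = seq (entry (A p pp)) (suc (k p pp))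

  opaque
    H : ∀ p (pp : Prime p) → HermiteData p (suc (k p pp)) (K p pp M2.m11) (K p pp M2.m12) (K p pp M2.m21) (K p pp M2.m22)
    H p pp = hermite-data pp (k p pp) _ _ _ _ (seq (proj₁ (proj₂ (proj₂ (α p pp)))) (suc (k p pp)))
                          (proj₂ (proj₂ (proj₂ (α p pp))) (suc (k p pp)))

  module H p pp = HermiteData (H p pp)

  P Q : ℤ
  P = ∏-primes< H.j (suc N)
  Q = ∏-primes< H.l (suc N)

  -- only meaningful for q ≤ N; the value 0 beyond N is never used
  cofactor : (f : PrimeExponents) → (q : ℕ) → Prime q → ℤ
  cofactor f q pq with q ℕP.<? suc N
  ... | yes q≤N = proj₁ (∏-primes<-split f (suc N) pq q≤N)
  ... | no _ = 0ℤ

  cofactor-spec : ∀ f q pq → q ℕ.< suc N →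
    (∏-primes< f (suc N) ≡ q ^ℤ f q pq * cofactor f q pq) × Coprime (+ q) (cofactor f q pq)
  cofactor-spec f q pq q≤N with q ℕP.<? suc N
  ... | yes q≤N′ = proj₂ (∏-primes<-split f (suc N) pq q≤N′)
  ... | no q≰N = ⊥-elim (q≰N q≤N)

  P′ Q′ : (q : ℕ) → Prime q → ℤ
  P′ = cofactor H.j
  Q′ = cofactor H.l

  X-coefficient X-target : (q : ℕ) → Prime q → ℤ
  X-coefficient q pq = pick (H.a′⊥p⊎c′⊥p q pq) (H.a′ q pq) (H.c′ q pq)
  X-target q pq = pick (H.a′⊥p⊎c′⊥p q pq) (K q pq M2.m12 * P′ q pq) (K q pq M2.m22 * P′ q pq)

  X-solution : Σ ℤ (SolvesBelow H.l X-coefficient X-target (λ q pq → pick-coprime (H.a′⊥p⊎c′⊥p q pq)) (suc N))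
  X-solution = chinese-remainder H.l X-coefficient X-target (λ q pq → pick-coprime (H.a′⊥p⊎c′⊥p q pq)) (suc N)

  X : ℤ
  X = proj₁ X-solution

  X-congruences : ∀ q pq → q ℕ.< suc N →
    (q ^ℤ H.l q pq ∣ K q pq M2.m12 * P′ q pq - H.a′ q pq * X) × (q ^ℤ H.l q pq ∣ K q pq M2.m22 * P′ q pq - H.c′ q pq * X)
  X-congruences q pq q≤N = picked-congruence⇒both (H.a′⊥p⊎c′⊥p q pq) (H.l q pq) _ _ (P′ q pq) X
    (subst (q ^ℤ H.l q pq ∣_) (sym (H.minor≡ q pq)) (n∣n*m (q ^ℤ H.l q pq) (H.e q pq)))
    (proj₂ X-solution q pq q≤N)

  opaque
    cofactor-data : ∀ p (pp : Prime p) → CofactorData (A p pp) (upper P X Q)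
    cofactor-data p pp with p ℕP.<? suc N
    ... | yes p≤N = cofactor-data-hermite pp (A₁₁ p pp) (A₁₂ p pp) (A₂₁ p pp) (A₂₂ p pp) P X Q (k p pp) (H p pp)
                      (P′ p pp) (Q′ p pp) (proj₁ (cofactor-spec H.j p pp p≤N)) (proj₂ (cofactor-spec H.j p pp p≤N))
                      (proj₁ (cofactor-spec H.l p pp p≤N)) (proj₂ (cofactor-spec H.l p pp p≤N))
                      (proj₁ (X-congruences p pp p≤N)) (proj₂ (X-congruences p pp p≤N))
    ... | no p≰N = cofactor-data-unimodular pp (A₁₁ p pp) (A₁₂ p pp) (A₂₁ p pp) (A₂₂ p pp) P X Q
                     (∏-primes<-coprime H.j (suc N) pp (ℕP.≮⇒≥ p≰N)) (∏-primes<-coprime H.l (suc N) pp (ℕP.≮⇒≥ p≰N))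
                     (unit-beyond-N p pp (ℕP.≮⇒≥ p≰N))

    v-beyond-N : ∀ p (pp : Prime p) → ¬ (p ℕ.< suc N) → CofactorData.v (cofactor-data p pp) ≡ 0
    v-beyond-N p pp p≰N with p ℕP.<? suc N
    ... | yes p≤N = ⊥-elim (p≰N p≤N)
    ... | no _ = refl

  module U p pp = UnitCofactor pp (A₁₁ p pp) (A₁₂ p pp) (A₂₁ p pp) (A₂₂ p pp) (a₁ p pp) (a₂ p pp) P X 0ℤ Q
                                (cofactor-data p pp)

  v : PrimeExponents
  v p pp = CofactorData.v (cofactor-data p pp)

  approximate : (t : (q : ℕ) → Prime q → ℤ) → Σ ℤ λ b → ∀ q pq → q ^ℤ v q pq ∣ t q pq - b
  approximate t = b , λ q pq → subst (λ w → q ^ℤ v q pq ∣ t q pq - w) (ℤP.*-identityˡ b) (all-primes q pq)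
    where
    solution : Σ ℤ (SolvesBelow v (λ _ _ → 1ℤ) t (λ q _ → coprime-1 (+ q)) (suc N))
    solution = chinese-remainder v (λ _ _ → 1ℤ) t (λ q _ → coprime-1 (+ q)) (suc N)
    b : ℤ
    b = proj₁ solution
    all-primes : ∀ q pq → q ^ℤ v q pq ∣ t q pq - 1ℤ * b
    all-primes q pq with q ℕP.<? suc N
    ... | yes q≤N = proj₂ solution q pq q≤N
    ... | no q≰N = subst (λ w → q ^ℤ w ∣ t q pq - 1ℤ * b) (sym (v-beyond-N q pq q≰N)) (1∣n _)

  b₁ b₂ : ℤ
  b₁ = proj₁ (approximate U.target₁)
  b₂ = proj₁ (approximate U.target₂)

  detB≢0 : P * Q - X * 0ℤ ≢ 0ℤ
  detB≢0 detB≡0 = ℕ.≢-nonZero⁻¹ ∣ P * Q ∣ {{ℤP.i*j≢0 P Q {{∏-primes<-nonZero H.j (suc N)}} {{∏-primes<-nonZero H.l (suc N)}}}}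
                    (cong ∣_∣ (trans (sym (drop-zero P X Q)) detB≡0))
    where drop-zero : ∀ P X Q → P * Q - X * 0ℤ ≡ P * Q
          drop-zero = solve-∀

  preimage : Σ ΔH λ β → η (proj₁ β) ∼Γ̂ famOf (α , N , unit-beyond-N)
  preimage = ((upper P X Q , vec b₁ b₂) , detB≢0) ,
             (λ q pq → (U.C q pq , U.c q pq b₁ b₂ (proj₂ (approximate U.target₁) q pq) (proj₂ (approximate U.target₂) q pq)) ,
                       U.C-unit q pq) ,
             (λ q pq → U.C·B≈A q pq ,
                       U.Cb+detB·c≈a q pq b₁ b₂ (proj₂ (approximate U.target₁) q pq) (proj₂ (approximate U.target₂) q pq))

η-surjective : (α : ΔHat) → Σ ΔH λ β → η (proj₁ β) ∼Γ̂ famOf α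
η-surjective (α , N , unit-beyond-N) = Surjectivity.preimage α N unit-beyond-N

lemma3p4 :
    -- η_* is well defined on Γ_H \ Δ_H
    ((β β' : ΔH) → β ∼Γ β' → η (proj₁ β) ∼Γ̂ η (proj₁ β'))
    -- η_* is injective
    × ((β β' : ΔH) → η (proj₁ β) ∼Γ̂ η (proj₁ β') → β ∼Γ β')
    -- η_* is surjective
    × ((α : ΔHat) → Σ ΔH λ β → η (proj₁ β) ∼Γ̂ famOf α)
lemma3p4 = η-respects-∼Γ , η-injective , η-surjective
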